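{- Let $n\ge 4$ and $1\le k<n-3$. Define words over $\{\sigma,\tau\}$ by $W_0=\sigma$ and, for $1\le j<n-3$, $$W_j=\tau\cdot\prod_{i=1}^{n-2}\sigma^i\,W_{\Delta(j,i)}\,\gamma_{n-2-i}.$$ Then for every seed $\psi\notin \mathrm{Hub}_n$ with $\mathrm{height}(\psi)=k$, the permutation $\psi^{(n-1)}$ occurs after $\widetilde{\psi}$ on $\mathrm{PATH}(n)$, and the word of labels of the segment of $\mathrm{PATH}(n)$ from $\widetilde{\psi}$ to $\psi^{(n-1)}$ is exactly $W_k$.
   Context: An $n$-permutation is a sequence $(a_1,\dots,a_n)$ listing each element of $\{1,\dots,n\}$ once. Define $\sigma(a_1,\dots,a_n)=(a_2,\dots,a_n,a_1)$ and $\tau(a_1,\dots,a_n)=(a_2,a_1,a_3,\dots,a_n)$. Words over $\{\sigma,\tau\}$ act from left to right ($w_1w_2\cdots w_m$ applies $w_1$ first); powers denote repetition, $\prod$ denotes concatenation in increasing order of the index, $\gamma_k=\sigma^k\tau$, and $\Delta(k,i)=\min(k-1,n-2-i)$. On $\{1,\dots,n-1\}$ let $a\oplus1=a+1$ for $a<n-1$, $(n-1)\oplus1=1$, let $a\ominus1$ be the $b$ with $b\oplus1=a$, and iterate to get $a\ominus j$. A seed is a tuple $\psi=(a_1,\dots,a_{n-1})$ of distinct elements of $\{1,\dots,n\}$ with $a_1=n$ such that the unique element of $\{1,\dots,n\}$ not occurring in $\psi$ equals $a_2\oplus1$; it is denoted $\mathrm{mis}(\psi)$. $\mathrm{perms}(\psi)$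 is the set of $n$-permutations obtained by inserting $\mathrm{mis}(\psi)$ at any position of $\psi$ and then applying any cyclic shift. $\mathrm{height}(\psi)$ is the largest $k\in\{1,\dots,n-2\}$ such that $a_j=a_{j+1}\oplus1$ for all $2\le j\le k$. $\mathrm{Hub}_n=\{(n,b,b\ominus1,\dots,b\ominus(n-3)):1\le b\le n-1\}$. $\widetilde{\psi}=(a_1,\mathrm{mis}(\psi),a_2,\dots,a_{n-1})$ and $\psi^{(n-1)}=(\mathrm{mis}(\psi),a_2,\dots,a_{n-1},a_1)$. $\mathrm{PATH}(n)$: let $\pi_0=(n,n-1,\dots,1)$. In the directed graph on all $n$-permutations, each $\pi$ gets the single outgoing edge $\pi\to\tau(\pi)$ labelled $\tau$ if there is a seed $\psi$ with $\pi\in\mathrm{perms}(\psi)$ whose missing element is the second entry of $\pi$, and $\pi\to\sigma(\pi)$ labelled $\sigma$ otherwise; then the edge $\pi_0\to\tau(\pi_0)$ is replaced by $\pi_0\to\sigma(\pi_0)$ (labelled $\sigma$) and the outgoing edge of $\tau(\sigma(\pi_0))$ is deleted. The result is a Hamiltonian path from $\tau(\pi_0)$ to $\tau(\sigma(\pi_0))$ (the Sawada–Williams $\sigma\tau$-generation). -}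

module Defs where

open import Data.Nat using (ℕ; zero; suc; _+_; _∸_; _≤_; _<_; _⊓_; _<ᵇ_; _≡ᵇ_)
open import Data.Bool using (if_then_else_)
open import Data.List using (List; []; _∷_; _++_; [_]; map; upTo; downFrom; replicate; concatMap; length; take; drop)
open import Data.List.Relation.Unary.All using (All)
open import Data.List.Relation.Unary.Unique.Propositional using (Unique)
open import Data.List.Membership.Propositional using (_∈_; _∉_)
open import Data.Product using (Σ; ∃; _×_; _,_)
open import Data.Sum using (_⊎_)
open import Relation.Nullary using (¬_)
open import Relation.Binary.PropositionalEquality using (_≡_; _≢_)

Perm : Set
Perm = List ℕ

data Gen : Set where
  sig tau : Gen

σ : Perm → Perm
σ []       = []
σ (a ∷ as) = as ++ [ a ]

τ : Perm → Perm
τ (a ∷ b ∷ as) = b ∷ a ∷ as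
τ xs           = xs

σ^ : ℕ → List Gen
σ^ i = replicate i sig

γ : ℕ → List Gen
γ k = σ^ k ++ [ tau ]

-- The words W_j (for a fixed n), defined with fuel; Δ(j+1,i) = min(j, n-2-i).
Wf : ℕ → ℕ → ℕ → List Gen
Wf n zero    j       = []
Wf n (suc f) zero    = [ sig ]
Wf n (suc f) (suc j) =
  tau ∷ concatMap (λ i → σ^ i ++ Wf n f (j ⊓ (n ∸ 2 ∸ i)) ++ γ (n ∸ 2 ∸ i))
                  (map suc (upTo (n ∸ 2)))

-- W n j = W_j ; fuel j+1 suffices since Δ(j,i) ≤ j-1.
W : ℕ → ℕ → List Gen
W n j = Wf n (suc j) j

_⊕1[_] : ℕ → ℕ → ℕ
a ⊕1[ n ] = if suc a <ᵇ n then suc a else 1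

_⊖1[_] : ℕ → ℕ → ℕ
a ⊖1[ n ] = if a ≡ᵇ 1 then n ∸ 1 else a ∸ 1

ominus : ℕ → ℕ → ℕ → ℕ
ominus n a zero    = a
ominus n a (suc j) = (ominus n a j) ⊖1[ n ]

-- 1-indexed entry a_j of a list (junk 0 outside range)
entry : List ℕ → ℕ → ℕ
entry []       _             = 0
entry (x ∷ xs) zero          = 0
entry (x ∷ xs) (suc zero)    = x
entry (x ∷ xs) (suc (suc j)) = entry xs (suc j)

mis : ℕ → List ℕ → ℕ
mis n ψ = (entry ψ 2) ⊕1[ n ]

IsSeed : ℕ → List ℕ → Set
IsSeed n ψ =
  length ψ ≡ n ∸ 1
  × Unique ψ
  × All (λ x → 1 ≤ x × x ≤ n) ψ
  × (Σ (List ℕ) λ rest → ψ ≡ n ∷ rest)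
  × (1 ≤ mis n ψ × mis n ψ ≤ n × mis n ψ ∉ ψ)
  × (∀ m → 1 ≤ m → m ≤ n → m ∉ ψ → m ≡ mis n ψ)

insertAt : ℕ → ℕ → List ℕ → List ℕ
insertAt i m xs = take i xs ++ m ∷ drop i xs

rotate : ℕ → List ℕ → List ℕ
rotate j xs = drop j xs ++ take j xs

InPerms : ℕ → List ℕ → Perm → Set
InPerms n ψ π = Σ ℕ λ i → Σ ℕ λ j →
  i ≤ length ψ × j < n × π ≡ rotate j (insertAt i (mis n ψ) ψ)

TauCond : ℕ → Perm → Set
TauCond n π = Σ (List ℕ) λ ψ → IsSeed n ψ × InPerms n ψ π
  × (Σ ℕ λ x → Σ (List ℕ) λ rest → π ≡ x ∷ mis n ψ ∷ rest)

π₀ : ℕ → Perm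
π₀ n = map suc (downFrom n)

Edge : ℕ → Perm → Gen → Perm → Set
Edge n π g π' =
  π ≢ τ (σ (π₀ n)) ×
  ( (π ≡ π₀ n × g ≡ sig × π' ≡ σ π)
  ⊎ (π ≢ π₀ n × TauCond n π × g ≡ tau × π' ≡ τ π)
  ⊎ (π ≢ π₀ n × ¬ TauCond n π × g ≡ sig × π' ≡ σ π))

data Seg (n : ℕ) (t : Perm) : Perm → List Gen → Set where
  done : Seg n t t []
  step : ∀ {π π' g w} → π ≢ t → Edge n π g π' → Seg n t π' w → Seg n t π (g ∷ w)

Chain : List ℕ → ℕ → ℕ → Set
Chain ψ n k = ∀ j → 2 ≤ j → j ≤ k → entry ψ j ≡ (entry ψ (suc j)) ⊕1[ n ]

Height : ℕ → List ℕ → ℕ → Set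
Height n ψ k = (1 ≤ k × k ≤ n ∸ 2) × Chain ψ n k
  × (∀ k' → k < k' → k' ≤ n ∸ 2 → ¬ Chain ψ n k')

InHub : ℕ → List ℕ → Set
InHub n ψ = Σ ℕ λ b → 1 ≤ b × b ≤ n ∸ 1 × ψ ≡ n ∷ map (ominus n b) (upTo (n ∸ 2))

tilde : ℕ → List ℕ → Perm
tilde n []       = []
tilde n (a ∷ as) = a ∷ mis n (a ∷ as) ∷ as

shiftLast : ℕ → List ℕ → Perm
shiftLast n []       = []
shiftLast n (a ∷ as) = mis n (a ∷ as) ∷ as ++ [ a ]

module Submission where

open import Defs
open import Data.Bool using (T; false; true)
open import Data.Empty using (⊥-elim)
open import Data.List using (List; []; _∷_; _++_; [_]; concat; concatMap; downFrom; drop; filter; length; map; take; upTo)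
open import Data.List.Membership.Propositional using (_∈_; _∉_)
open import Data.List.Membership.Propositional.Properties using (∈-++⁺ʳ; ∈-++⁺ˡ; ∈-++⁻; ∈-filter⁻)
open import Data.List.Properties
  using (++-assoc; ++-identityʳ; concatMap-++; drop-drop; filter-++; filter-accept; filter-all; filter-none; filter-reject;
         length-++; map-++; map-cong; take++drop≡id; upTo-∷ʳ; ∷-injective; ∷ʳ-injectiveˡ; ≡-dec)
open import Data.List.Relation.Unary.All as All using (All)
open import Data.List.Relation.Unary.AllPairs using (_∷_)
open import Data.List.Relation.Unary.Any using (here; there)
open import Data.List.Relation.Unary.Unique.Propositional using (Unique)
open import Data.List.Relation.Unary.Unique.Propositional.Properties using (drop⁺)
open import Data.Nat using (ℕ; zero; suc; _+_; _∸_; _≤_; _<_; _⊓_; z≤n; s≤s; _≟_; _≤?_; _<?_; _<ᵇ_)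
open import Data.Nat.Induction using (<-rec)
open import Data.List.Membership.DecPropositional _≟_ using (_∈?_)
open import Data.Nat.Properties
open import Data.Product using (Σ; _×_; _,_; proj₁; proj₂)
open import Data.Sum using (_⊎_; inj₁; inj₂)
open import Data.Unit using (tt)
open import Function using (_∘_)
open import Relation.Nullary using (¬_; Dec; yes; no; contradiction)
open import Relation.Binary.PropositionalEquality
  using (_≡_; _≢_; refl; sym; trans; cong; cong₂; subst; subst₂; module ≡-Reasoning)

-- From ψ̃ = (n, m, a₂, …, a_{n-1}), where
-- m = a₂ ⊕ 1, the τ-edge exists because ψ̃ ∈ perms(ψ), giving (m, n, a₂, …, a_{n-1}). The i-th
-- block then moves x = a_{n-i} across m: σ^i brings n to the front of n ∷ Q ++ x ∷ m ∷ P₂, which is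
-- ψ̃′ for the seed ψ′ = n ∷ Q′ ++ x ∷ m ∷ P₂ (Q = a₂ ∷ Q′), with missing element a₂ and height
-- Δ(k,i) < k; by induction W_{Δ(k,i)} leads to ψ′^{(n-1)} (when Δ(k,i) = 0 the single σ is checked
-- directly), and γ_{n-2-i} rotates back and swaps x and m. Along the σ-stretches, a τ-edge at x ∷ y ∷ r would make y the missing element of the seed
-- rotateTo n (x ∷ r), which fails for each visited permutation. Finally, every visited permutation
-- keeps n, a_{k+1}, …, a_{n-1} in cyclic order; the invariant of an inner segment implies the outer
-- one and excludes ψ^{(n-1)}, so the target is reached only at the end.


++-≡-++ : ∀ {A : Set} (a b c d : List A) → a ++ b ≡ c ++ d →
  (Σ (List A) λ w → c ≡ a ++ w × b ≡ w ++ d) ⊎ (Σ (List A) λ w → a ≡ c ++ w × d ≡ w ++ b)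
++-≡-++ []      b c       d eq = inj₁ (c , refl , eq)
++-≡-++ (x ∷ a) b []      d eq = inj₂ (x ∷ a , refl , sym eq)
++-≡-++ (x ∷ a) b (y ∷ c) d eq with ∷-injective eq
... | refl , eq′ with ++-≡-++ a b c d eq′
... | inj₁ (w , p , q) = inj₁ (w , cong (x ∷_) p , q)
... | inj₂ (w , p , q) = inj₂ (w , cong (x ∷_) p , q)

∈-take⁻ : ∀ {z : ℕ} i xs → z ∈ take i xs → z ∈ xs
∈-take⁻ i xs p = subst (_ ∈_) (take++drop≡id i xs) (∈-++⁺ˡ p)

∈-drop⁻ : ∀ {z : ℕ} i xs → z ∈ drop i xs → z ∈ xs
∈-drop⁻ i xs p = subst (_ ∈_) (take++drop≡id i xs) (∈-++⁺ʳ (take i xs) p)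

module _ {c : ℕ} where

  ∉-++⁺ : ∀ {xs ys} → c ∉ xs → c ∉ ys → c ∉ xs ++ ys
  ∉-++⁺ {xs} c∉xs c∉ys c∈ with ∈-++⁻ xs c∈
  ... | inj₁ p = c∉xs p
  ... | inj₂ p = c∉ys p

  ∉-++⁻ˡ : ∀ {xs ys} → c ∉ xs ++ ys → c ∉ xs
  ∉-++⁻ˡ c∉ p = c∉ (∈-++⁺ˡ p)

  ∉-++⁻ʳ : ∀ xs {ys} → c ∉ xs ++ ys → c ∉ ys
  ∉-++⁻ʳ xs c∉ p = c∉ (∈-++⁺ʳ xs p)

  ∉-∷⁺ : ∀ {y ys} → c ≢ y → c ∉ ys → c ∉ y ∷ ys
  ∉-∷⁺ c≢y c∉ys (here p)  = c≢y p
  ∉-∷⁺ c≢y c∉ys (there p) = c∉ys p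

  ∉-take : ∀ i xs → c ∉ xs → c ∉ take i xs
  ∉-take i xs c∉ = c∉ ∘ ∈-take⁻ i xs

  ∉-drop : ∀ i xs → c ∉ xs → c ∉ drop i xs
  ∉-drop i xs c∉ = c∉ ∘ ∈-drop⁻ i xs

uniq-head : ∀ {x : ℕ} {xs} → Unique (x ∷ xs) → x ∉ xs
uniq-head (x∉ ∷ _) p = All.lookup x∉ p refl

uniq-++-disjoint : ∀ (A : List ℕ) {B z} → Unique (A ++ B) → z ∈ A → z ∉ B
uniq-++-disjoint (a ∷ A) u (here refl) p = uniq-head u (∈-++⁺ʳ A p)
uniq-++-disjoint (a ∷ A) (_ ∷ u) (there q) p = uniq-++-disjoint A u q p

uniq-insert : ∀ (A : List ℕ) {B m} → Unique (A ++ B) → m ∉ A ++ B → Unique (A ++ m ∷ B)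
uniq-insert []      u m∉ = All.tabulate (λ p e → m∉ (subst (_∈ _) (sym e) p)) ∷ u
uniq-insert (a ∷ A) {B} {m} (a∉ ∷ u) m∉ = All.tabulate a∉′ ∷ uniq-insert A u (m∉ ∘ there)
  where
  a∉′ : ∀ {z} → z ∈ A ++ m ∷ B → a ≢ z
  a∉′ p refl with ∈-++⁻ A p
  ... | inj₁ q         = All.lookup a∉ (∈-++⁺ˡ q) refl
  ... | inj₂ (here e)  = m∉ (here (sym e))
  ... | inj₂ (there q) = All.lookup a∉ (∈-++⁺ʳ A q) refl

take-length-++ : ∀ (A B : List ℕ) → take (length A) (A ++ B) ≡ A
take-length-++ []      B = refl
take-length-++ (a ∷ A) B = cong (a ∷_) (take-length-++ A B)

drop-length-++ : ∀ (A B : List ℕ) → drop (length A) (A ++ B) ≡ B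
drop-length-++ []      B = refl
drop-length-++ (a ∷ A) B = drop-length-++ A B

take-suc-length : ∀ (A : List ℕ) y R → take (suc (length A)) (A ++ y ∷ R) ≡ A ++ [ y ]
take-suc-length []      y R = refl
take-suc-length (a ∷ A) y R = cong (a ∷_) (take-suc-length A y R)

drop-suc-length : ∀ (A : List ℕ) y R → drop (suc (length A)) (A ++ y ∷ R) ≡ R
drop-suc-length []      y R = refl
drop-suc-length (a ∷ A) y R = drop-suc-length A y R

rotate-length-++ : ∀ (A B : List ℕ) → rotate (length A) (A ++ B) ≡ B ++ A
rotate-length-++ A B = cong₂ _++_ (drop-length-++ A B) (take-length-++ A B)

drop-++ˡ : ∀ d (A B : List ℕ) → d ≤ length A → drop d (A ++ B) ≡ drop d A ++ B
drop-++ˡ zero    A       B _         = refl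
drop-++ˡ (suc d) (a ∷ A) B (s≤s d≤A) = drop-++ˡ d A B d≤A

∈-drop-mono : ∀ {z : ℕ} d e Z → d ≤ e → z ∈ drop e Z → z ∈ drop d Z
∈-drop-mono zero    e       Z       _         p = ∈-drop⁻ e Z p
∈-drop-mono (suc d) (suc e) (x ∷ Z) (s≤s d≤e) p = ∈-drop-mono d e Z d≤e p

lastOr0 : List ℕ → ℕ
lastOr0 []           = 0
lastOr0 (x ∷ [])     = x
lastOr0 (x ∷ y ∷ xs) = lastOr0 (y ∷ xs)

lastOr0-∈ : ∀ A y B → lastOr0 (A ++ y ∷ B) ∈ y ∷ B
lastOr0-∈ []           y []      = here refl
lastOr0-∈ []           y (b ∷ B) = there (lastOr0-∈ [] b B)
lastOr0-∈ (a ∷ [])     y B       = lastOr0-∈ [] y B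
lastOr0-∈ (a ∷ a′ ∷ A) y B       = lastOr0-∈ (a′ ∷ A) y B

lastOr0-∷ʳ : ∀ A y → lastOr0 (A ++ [ y ]) ≡ y
lastOr0-∷ʳ A y with lastOr0-∈ A y []
... | here e = e


-- The rotation of L starting with c (L itself when c ∉ L).
rotateTo′ : ℕ → List ℕ → List ℕ → List ℕ
rotateTo′ c []       acc = acc
rotateTo′ c (x ∷ xs) acc with x ≟ c
... | yes _ = x ∷ xs ++ acc
... | no  _ = rotateTo′ c xs (acc ++ [ x ])

rotateTo : ℕ → List ℕ → List ℕ
rotateTo c L = rotateTo′ c L []

rotateTo′-split : ∀ c u v acc → c ∉ u → rotateTo′ c (u ++ c ∷ v) acc ≡ c ∷ v ++ acc ++ u
rotateTo′-split c [] v acc _ with c ≟ c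
... | yes _ = cong (λ a → c ∷ v ++ a) (sym (++-identityʳ acc))
... | no c≢c = contradiction refl c≢c
rotateTo′-split c (x ∷ u) v acc c∉ with x ≟ c
... | yes refl = contradiction (here refl) c∉
... | no _ = trans (rotateTo′-split c u v (acc ++ [ x ]) (λ p → c∉ (there p)))
                   (cong (λ a → c ∷ v ++ a) (++-assoc acc [ x ] u))

rotateTo-split : ∀ c u v → c ∉ u → rotateTo c (u ++ c ∷ v) ≡ c ∷ v ++ u
rotateTo-split c u v = rotateTo′-split c u v []

rotateTo′≡⇒split : ∀ c T X acc → c ∉ acc → c ∉ T → rotateTo′ c X acc ≡ c ∷ T →
  Σ (List ℕ) λ u → Σ (List ℕ) λ v → X ≡ u ++ c ∷ v × c ∉ u × c ∉ v × v ++ acc ++ u ≡ T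
rotateTo′≡⇒split c T [] acc c∉acc c∉T eq = ⊥-elim (c∉acc (subst (c ∈_) (sym eq) (here refl)))
rotateTo′≡⇒split c T (y ∷ X) acc c∉acc c∉T eq with y ≟ c
... | yes refl = [] , X , refl , (λ ()) , ∉-++⁻ˡ (subst (c ∉_) (sym eq′) c∉T) ,
                 trans (cong (X ++_) (++-identityʳ acc)) eq′
  where eq′ = proj₂ (∷-injective eq)
... | no y≢c with rotateTo′≡⇒split c T X (acc ++ [ y ]) (∉-++⁺ c∉acc (∉-∷⁺ (λ e → y≢c (sym e)) λ ())) c∉T eq
... | u , v , refl , c∉u , c∉v , eq′ =
  y ∷ u , v , refl , ∉-∷⁺ (λ e → y≢c (sym e)) c∉u , c∉v , trans (cong (v ++_) (sym (++-assoc acc [ y ] u))) eq′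

rotateTo≡⇒split : ∀ c T X → c ∉ T → rotateTo c X ≡ c ∷ T →
  Σ (List ℕ) λ u → Σ (List ℕ) λ v → X ≡ u ++ c ∷ v × c ∉ u × c ∉ v × v ++ u ≡ T
rotateTo≡⇒split c T X = rotateTo′≡⇒split c T X [] λ ()

IsRotation : List ℕ → List ℕ → Set
IsRotation L L′ = Σ (List ℕ) λ A → Σ (List ℕ) λ B → L ≡ A ++ B × L′ ≡ B ++ A

rotation-split : ∀ {L L′} c u v → IsRotation L L′ → L ≡ u ++ c ∷ v → c ∉ u → c ∉ v →
  Σ (List ℕ) λ u′ → Σ (List ℕ) λ v′ → L′ ≡ u′ ++ c ∷ v′ × c ∉ u′ × c ∉ v′ × v′ ++ u′ ≡ v ++ u
rotation-split c u v (A , B , refl , refl) eq c∉u c∉v with ++-≡-++ A B u (c ∷ v) eq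
... | inj₁ (w , refl , refl) =
  w , v ++ A , ++-assoc w (c ∷ v) A , ∉-++⁻ʳ A c∉u , ∉-++⁺ c∉v (∉-++⁻ˡ c∉u) , ++-assoc v A w
... | inj₂ ([] , refl , refl) =
  [] , v ++ u ++ [] , refl , (λ ()) , ∉-++⁺ c∉v (∉-++⁺ c∉u λ ()) ,
  trans (++-identityʳ _) (cong (v ++_) (++-identityʳ u))
... | inj₂ (y ∷ w , refl , e) with ∷-injective e
... | refl , refl = B ++ u , w , sym (++-assoc B u (c ∷ w)) ,
      ∉-++⁺ (∉-++⁻ʳ w c∉v) c∉u , ∉-++⁻ˡ c∉v , sym (++-assoc w B u)

rotateTo-rotation : ∀ {L L′} c u v → IsRotation L L′ → L ≡ u ++ c ∷ v → c ∉ u → c ∉ v →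
  rotateTo c L′ ≡ c ∷ v ++ u
rotateTo-rotation c u v rot eq c∉u c∉v with rotation-split c u v rot eq c∉u c∉v
... | u′ , v′ , refl , c∉u′ , _ , e = trans (rotateTo-split c u′ v′ c∉u′) (cong (c ∷_) e)


restrict : List ℕ → List ℕ → List ℕ
restrict S = filter (_∈? S)

restrict-⊆ : ∀ {z} S L → z ∈ restrict S L → z ∈ L
restrict-⊆ S L p = proj₁ (∈-filter⁻ (_∈? S) p)

restrict-∈ : ∀ S x L → x ∈ S → restrict S (x ∷ L) ≡ x ∷ restrict S L
restrict-∈ S x L = filter-accept (_∈? S)

restrict-∉ : ∀ S x L → x ∉ S → restrict S (x ∷ L) ≡ restrict S L
restrict-∉ S x L = filter-reject (_∈? S)

restrict-++ : ∀ S A B → restrict S (A ++ B) ≡ restrict S A ++ restrict S B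
restrict-++ S = filter-++ (_∈? S)

restrict-restrict : ∀ S S′ L → (∀ {z} → z ∈ S → z ∈ S′) → restrict S (restrict S′ L) ≡ restrict S L
restrict-restrict S S′ [] S⊆S′ = refl
restrict-restrict S S′ (x ∷ L) S⊆S′ = by-cases (x ∈? S) (x ∈? S′)
  where
  open ≡-Reasoning
  IH = restrict-restrict S S′ L S⊆S′
  by-cases : Dec (x ∈ S) → Dec (x ∈ S′) → restrict S (restrict S′ (x ∷ L)) ≡ restrict S (x ∷ L)
  by-cases (yes x∈S) (yes x∈S′) = begin
    restrict S (restrict S′ (x ∷ L)) ≡⟨ cong (restrict S) (restrict-∈ S′ x L x∈S′) ⟩
    restrict S (x ∷ restrict S′ L)   ≡⟨ restrict-∈ S x _ x∈S ⟩
    x ∷ restrict S (restrict S′ L)   ≡⟨ cong (x ∷_) IH ⟩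
    x ∷ restrict S L                 ≡⟨ restrict-∈ S x L x∈S ⟨
    restrict S (x ∷ L)               ∎
  by-cases (yes x∈S) (no x∉S′) = contradiction (S⊆S′ x∈S) x∉S′
  by-cases (no x∉S) (yes x∈S′) = begin
    restrict S (restrict S′ (x ∷ L)) ≡⟨ cong (restrict S) (restrict-∈ S′ x L x∈S′) ⟩
    restrict S (x ∷ restrict S′ L)   ≡⟨ restrict-∉ S x _ x∉S ⟩
    restrict S (restrict S′ L)       ≡⟨ IH ⟩
    restrict S L                     ≡⟨ restrict-∉ S x L x∉S ⟨
    restrict S (x ∷ L)               ∎
  by-cases (no x∉S) (no x∉S′) = begin
    restrict S (restrict S′ (x ∷ L)) ≡⟨ cong (restrict S) (restrict-∉ S′ x L x∉S′) ⟩
    restrict S (restrict S′ L)       ≡⟨ IH ⟩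
    restrict S L                     ≡⟨ restrict-∉ S x L x∉S ⟨
    restrict S (x ∷ L)               ∎

restrict-drop : ∀ Z c d e → Unique Z → c ∉ Z → d ≤ e → restrict (c ∷ drop e Z) (drop d Z) ≡ drop e Z
restrict-drop Z c d e uZ c∉Z d≤e = begin
    restrict S (drop d Z)                        ≡⟨ cong (restrict S) split ⟩
    restrict S (A ++ drop e Z)                   ≡⟨ restrict-++ S A (drop e Z) ⟩
    restrict S A ++ restrict S (drop e Z)        ≡⟨ cong₂ _++_ (filter-none (_∈? S) (All.tabulate A∉S))
                                                                  (filter-all (_∈? S) (All.tabulate there)) ⟩
    drop e Z                                     ∎
  where
  open ≡-Reasoning
  S = c ∷ drop e Z
  A = take (e ∸ d) (drop d Z)
  split : drop d Z ≡ A ++ drop e Z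
  split = trans (sym (take++drop≡id (e ∸ d) (drop d Z)))
                (cong (A ++_) (trans (drop-drop d (e ∸ d) Z) (cong (λ q → drop q Z) (m+[n∸m]≡n d≤e))))
  uAB : Unique (A ++ drop e Z)
  uAB = subst Unique split (drop⁺ d uZ)
  A∉S : ∀ {z} → z ∈ A → z ∉ S
  A∉S p (here refl) = c∉Z (∈-drop⁻ d Z (∈-take⁻ (e ∸ d) (drop d Z) p))
  A∉S p (there q)   = uniq-++-disjoint A uAB p q


⊕1-< : ∀ n a → suc a < n → a ⊕1[ n ] ≡ suc a
⊕1-< n a lt with suc a <ᵇ n in e
... | true  = refl
... | false = ⊥-elim (subst T e (<⇒<ᵇ lt))

⊕1-≮ : ∀ n a → ¬ suc a < n → a ⊕1[ n ] ≡ 1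
⊕1-≮ n a nlt with suc a <ᵇ n in e
... | false = refl
... | true  = ⊥-elim (nlt (<ᵇ⇒< (suc a) n (subst T (sym e) tt)))

⊕1<n : ∀ n a → 2 ≤ n → a ⊕1[ n ] < n
⊕1<n n a 2≤n with suc a <? n
... | yes lt  rewrite ⊕1-< n a lt = lt
... | no  nlt rewrite ⊕1-≮ n a nlt = 2≤n

1≤⊕1 : ∀ n a → 1 ≤ a ⊕1[ n ]
1≤⊕1 n a with suc a <ᵇ n
... | true  = s≤s z≤n
... | false = s≤s z≤n

_⊕[_]_ : ℕ → ℕ → ℕ → ℕ
a ⊕[ n ] zero  = a
a ⊕[ n ] suc c = (a ⊕[ n ] c) ⊕1[ n ]

⊕-+ : ∀ n a q p → a ⊕[ n ] (q + p) ≡ (a ⊕[ n ] p) ⊕[ n ] q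
⊕-+ n a zero    p = refl
⊕-+ n a (suc q) p = cong (_⊕1[ n ]) (⊕-+ n a q p)

⊕1-⊕ : ∀ n b c → (b ⊕1[ n ]) ⊕[ n ] c ≡ b ⊕[ n ] suc c
⊕1-⊕ n b c = trans (sym (⊕-+ n b c 1)) (cong (b ⊕[ n ]_) (+-comm c 1))

⊕-no-wrap : ∀ N a j → a + j ≤ N → a ⊕[ suc N ] j ≡ a + j
⊕-no-wrap N a zero    _   = sym (+-identityʳ a)
⊕-no-wrap N a (suc j) a+j<N = begin
  (a ⊕[ suc N ] j) ⊕1[ suc N ] ≡⟨ cong (_⊕1[ suc N ]) (⊕-no-wrap N a j (<⇒≤ a+j<N′)) ⟩
  (a + j) ⊕1[ suc N ]          ≡⟨ ⊕1-< (suc N) (a + j) (s≤s a+j<N′) ⟩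
  suc (a + j)                  ≡⟨ +-suc a j ⟨
  a + suc j                    ∎
  where
  open ≡-Reasoning
  a+j<N′ : a + j < N
  a+j<N′ = subst (_≤ N) (+-suc a j) a+j<N

⊕-≢ : ∀ N a j → 1 ≤ a → a ≤ N → 0 < j → j < N → a ⊕[ suc N ] j ≢ a
⊕-≢ N a j 1≤a a≤N 0<j j<N eq with a + j ≤? N
... | yes a+j≤N = <-irrefl (trans (sym eq) (⊕-no-wrap N a j a+j≤N)) (m<m+n a 0<j)
... | no  a+j≰N = <-irrefl j≡N j<N
  where
  r = N ∸ a
  a⊕r≡N : a ⊕[ suc N ] r ≡ N
  a⊕r≡N = trans (⊕-no-wrap N a r (≤-reflexive (m+[n∸m]≡n a≤N))) (m+[n∸m]≡n a≤N)
  a⊕1+r≡1 : a ⊕[ suc N ] suc r ≡ 1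
  a⊕1+r≡1 = trans (cong (_⊕1[ suc N ]) a⊕r≡N) (⊕1-≮ (suc N) N (<-irrefl refl))
  r<j : suc r ≤ j
  r<j = ≰⇒> (λ j≤r → a+j≰N (≤-trans (+-monoʳ-≤ a j≤r) (≤-reflexive (m+[n∸m]≡n a≤N))))
  s = j ∸ suc r
  j≡s+1+r : j ≡ s + suc r
  j≡s+1+r = sym (m∸n+n≡m r<j)
  a⊕j≡1+s : a ⊕[ suc N ] j ≡ 1 + s
  a⊕j≡1+s = begin
    a ⊕[ suc N ] j                   ≡⟨ cong (a ⊕[ suc N ]_) j≡s+1+r ⟩
    a ⊕[ suc N ] (s + suc r)         ≡⟨ ⊕-+ (suc N) a s (suc r) ⟩
    (a ⊕[ suc N ] suc r) ⊕[ suc N ] s ≡⟨ cong (_⊕[ suc N ] s) a⊕1+r≡1 ⟩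
    1 ⊕[ suc N ] s                   ≡⟨ ⊕-no-wrap N 1 s (≤-trans (s≤s (m∸n≤m j (suc r))) j<N) ⟩
    1 + s                            ∎
    where open ≡-Reasoning
  a≡1+s : a ≡ suc s
  a≡1+s = trans (sym eq) a⊕j≡1+s
  1+s≤N : suc s ≤ N
  1+s≤N = subst (_≤ N) a≡1+s a≤N
  j≡N : j ≡ N
  j≡N = begin
    j                   ≡⟨ j≡s+1+r ⟩
    s + suc (N ∸ a)     ≡⟨ cong (λ q → s + suc (N ∸ q)) a≡1+s ⟩
    s + suc (N ∸ suc s) ≡⟨ cong (s +_) (+-∸-assoc 1 1+s≤N) ⟨
    s + (N ∸ s)         ≡⟨ m+[n∸m]≡n (≤-trans (n≤1+n s) 1+s≤N) ⟩
    N                   ∎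
    where open ≡-Reasoning


module _ {n ψ} (seed : IsSeed n ψ) where

  seed-length : length ψ ≡ n ∸ 1
  seed-length = proj₁ seed

  seed-unique : Unique ψ
  seed-unique = proj₁ (proj₂ seed)

  seed-bounds : All (λ x → 1 ≤ x × x ≤ n) ψ
  seed-bounds = proj₁ (proj₂ (proj₂ seed))

  seed-mis∉ : mis n ψ ∉ ψ
  seed-mis∉ = proj₂ (proj₂ (proj₁ (proj₂ (proj₂ (proj₂ (proj₂ seed))))))

  seed-missing : ∀ m → 1 ≤ m → m ≤ n → m ∉ ψ → m ≡ mis n ψ
  seed-missing = proj₂ (proj₂ (proj₂ (proj₂ (proj₂ seed))))

-- 0-indexed entries: at L i is the paper's a_{i+1} of L, and at P i is a_{i+2} of h ∷ P.
at : List ℕ → ℕ → ℕ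
at L i = entry L (suc i)

TailChain : List ℕ → ℕ → ℕ → Set
TailChain P n k = ∀ i → 2 + i ≤ k → at P i ≡ at P (suc i) ⊕1[ n ]

Chain⇒TailChain : ∀ {h P n k} → Chain (h ∷ P) n k → TailChain P n k
Chain⇒TailChain ch i 2+i≤k = ch (2 + i) (s≤s (s≤s z≤n)) 2+i≤k

TailChain⇒Chain : ∀ {h P n k} → TailChain P n k → Chain (h ∷ P) n k
TailChain⇒Chain ch (suc (suc i)) (s≤s (s≤s _)) 2+i≤k = ch i 2+i≤k

TailChain⇒⊕ : ∀ n P c → (∀ i → i < c → at P i ≡ at P (suc i) ⊕1[ n ]) → at P 0 ≡ at P c ⊕[ n ] c
TailChain⇒⊕ n P zero    _  = refl
TailChain⇒⊕ n P (suc c) ch = begin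
  at P 0                                  ≡⟨ TailChain⇒⊕ n P c (λ i i<c → ch i (≤-trans i<c (n≤1+n c))) ⟩
  at P c ⊕[ n ] c                         ≡⟨ cong (_⊕[ n ] c) (ch c ≤-refl) ⟩
  (at P (suc c) ⊕1[ n ]) ⊕[ n ] c         ≡⟨ ⊕1-⊕ n (at P (suc c)) c ⟩
  at P (suc c) ⊕[ n ] suc c               ∎
  where open ≡-Reasoning

at-≡-prefix : ∀ (Q : List ℕ) x R R′ j → j ≤ length Q → at (Q ++ x ∷ R) j ≡ at (Q ++ x ∷ R′) j
at-≡-prefix []      x R R′ zero    _         = refl
at-≡-prefix (q ∷ Q) x R R′ zero    _         = refl
at-≡-prefix (q ∷ Q) x R R′ (suc j) (s≤s j≤Q) = at-≡-prefix Q x R R′ j j≤Q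

at-after : ∀ (Q : List ℕ) x m R → at (Q ++ x ∷ m ∷ R) (suc (length Q)) ≡ m
at-after []      x m R = refl
at-after (q ∷ Q) x m R = at-after Q x m R

descending : ℕ → List ℕ
descending N = map suc (downFrom N)

at-descending : ∀ N i → i < N → at (descending N) i ≡ N ∸ i
at-descending (suc N) zero    _         = refl
at-descending (suc N) (suc i) (s≤s i<N) = at-descending N i i<N

descending-TailChain : ∀ n3 → TailChain (descending (suc n3)) (3 + n3) (suc n3)
descending-TailChain n3 i 2+i≤ = begin
  at D i                 ≡⟨ at-descending (suc n3) i (s≤s i≤n3) ⟩
  suc n3 ∸ i             ≡⟨ +-∸-assoc 1 i≤n3 ⟩
  suc (n3 ∸ i)           ≡⟨ cong suc (sym next) ⟩
  suc (at D (suc i))     ≡⟨ ⊕1-< (3 + n3) (at D (suc i)) (s≤s (s≤s (subst (_≤ suc n3) (sym next) (≤-trans (m∸n≤m n3 i) (n≤1+n n3))))) ⟨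
  at D (suc i) ⊕1[ 3 + n3 ] ∎
  where
  open ≡-Reasoning
  D = descending (suc n3)
  i≤n3 : i ≤ n3
  i≤n3 = ≤-pred (≤-trans (n≤1+n _) 2+i≤)
  next : at D (suc i) ≡ n3 ∸ i
  next = at-descending (suc n3) (suc i) (s≤s (≤-pred 2+i≤))

-- A seed whose tail is descending has height n − 2.
Height⇒tail≢descending : ∀ n3 k P → k + 3 < 3 + n3 → Height (3 + n3) (3 + n3 ∷ P) k → P ≢ descending (suc n3)
Height⇒tail≢descending n3 k P k+3<n (_ , _ , maximal) refl =
  maximal (suc n3) k<1+n3 ≤-refl (TailChain⇒Chain {n = 3 + n3} (descending-TailChain n3))
  where
  k<1+n3 : k < suc n3
  k<1+n3 = ≤-trans (≤-pred (≤-pred (≤-pred (subst (_< 3 + n3) (+-comm k 3) k+3<n)))) (n≤1+n n3)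

Wf-fuel : ∀ n f f′ j → j < f → j < f′ → Wf n f j ≡ Wf n f′ j
Wf-fuel n (suc f) (suc f′) zero    _         _          = refl
Wf-fuel n (suc f) (suc f′) (suc j) (s≤s j<f) (s≤s j<f′) =
  cong (tau ∷_) (cong concat (map-cong (λ i → cong (λ w → σ^ i ++ w ++ γ (n ∸ 2 ∸ i))
    (Wf-fuel n f f′ (j ⊓ (n ∸ 2 ∸ i)) (≤-<-trans (m⊓n≤m j _) j<f) (≤-<-trans (m⊓n≤m j _) j<f′)))
    (map suc (upTo (n ∸ 2)))))


-- Walks along PATH(n)

rotation-delete-inserted : ∀ c ψ i j x r → c ∉ ψ → x ∷ c ∷ r ≡ rotate j (insertAt i c ψ) →
  IsRotation ψ (r ++ [ x ])
rotation-delete-inserted c ψ i j x r c∉ψ π≡ = take i ψ , drop i ψ , sym (take++drop≡id i ψ) , rest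
  where
  c∉before = ∉-take i ψ c∉ψ
  c∉after  = ∉-drop i ψ c∉ψ
  L = take i ψ ++ c ∷ drop i ψ
  from-c : rotateTo c (x ∷ c ∷ r) ≡ c ∷ drop i ψ ++ take i ψ
  from-c = trans (cong (rotateTo c) π≡)
    (rotateTo-rotation c (take i ψ) (drop i ψ) (take j L , drop j L , sym (take++drop≡id j L) , refl)
      refl c∉before c∉after)
  rest : r ++ [ x ] ≡ drop i ψ ++ take i ψ
  rest with x ≟ c
  ... | yes refl = contradiction (subst (c ∈_) (proj₂ (∷-injective (trans (sym (rotateTo-split c [] (c ∷ r) (λ ()))) from-c))) (here refl))
                                 (∉-++⁺ c∉after c∉before)
  ... | no x≢c = proj₂ (∷-injective (trans (sym (rotateTo-split c [ x ] r (∉-∷⁺ (λ e → x≢c (sym e)) λ ()))) from-c))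

rotateTo-rotation-head : ∀ c ψ′ x r → c ∉ ψ′ → IsRotation (c ∷ ψ′) (r ++ [ x ]) → rotateTo c (x ∷ r) ≡ c ∷ ψ′
rotateTo-rotation-head c ψ′ x r c∉ψ′ rot with rotation-split c [] ψ′ rot refl (λ ()) c∉ψ′
... | u , v , r++x≡ , c∉u , c∉v , v++u≡ = begin
  rotateTo c (x ∷ r) ≡⟨ rotateTo-rotation c u v (r , [ x ] , refl , refl) r++x≡ c∉u c∉v ⟩
  c ∷ v ++ u         ≡⟨ cong (c ∷_) (trans v++u≡ (++-identityʳ ψ′)) ⟩
  c ∷ ψ′             ∎
  where open ≡-Reasoning

TauCond⇒seed : ∀ n x y r → TauCond n (x ∷ y ∷ r) →
  Σ (List ℕ) λ ψ → IsSeed n ψ × y ≡ mis n ψ × rotateTo n (x ∷ r) ≡ ψ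
TauCond⇒seed n x y r (.(n ∷ ψ′) , seed@(_ , uψ , _ , (ψ′ , refl) , (_ , _ , c∉ψ) , _) , (i , j , _ , _ , π≡) , (_ , _ , π≡′))
  with ∷-injective π≡′
... | refl , π≡″ with ∷-injective π≡″
... | refl , _ = n ∷ ψ′ , seed , refl ,
  rotateTo-rotation-head n ψ′ x r (uniq-head uψ) (rotation-delete-inserted (mis n (n ∷ ψ′)) (n ∷ ψ′) i j x r c∉ψ π≡)

pathEnd : ℕ → Perm
pathEnd n = τ (σ (π₀ n))

σ-edge : ∀ {n π} → π ≢ pathEnd n → ¬ TauCond n π → Edge n π sig (σ π)
σ-edge {n} {π} π≢end ¬tau with ≡-dec _≟_ π (π₀ n)
... | yes π≡π₀ = π≢end , inj₁ (π≡π₀ , refl , refl)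
... | no  π≢π₀ = π≢end , inj₂ (inj₂ (π≢π₀ , ¬tau , refl , refl))

τ-edge : ∀ {n π} → π ≢ pathEnd n → π ≢ π₀ n → TauCond n π → Edge n π tau (τ π)
τ-edge π≢end π≢π₀ τ-ok = π≢end , inj₂ (inj₁ (π≢π₀ , τ-ok , refl , refl))

data Run (n : ℕ) (t : Perm) (I : Perm → Set) : Perm → List Gen → Perm → Set where
  [] : ∀ {π} → Run n t I π [] π
  _∷_ : ∀ {π π′ π″ g w} → π ≢ t × I π × Edge n π g π′ → Run n t I π′ w π″ → Run n t I π (g ∷ w) π″

infixr 5 _++ʳ_
_++ʳ_ : ∀ {n t I π π′ π″ w w′} → Run n t I π w π′ → Run n t I π′ w′ π″ → Run n t I π (w ++ w′) π″
[]      ++ʳ r′ = r′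
(e ∷ r) ++ʳ r′ = e ∷ (r ++ʳ r′)

Run-map : ∀ {n t t′ I I′ π w π′} → (∀ {ρ} → I ρ → ρ ≢ t′ × I′ ρ) → Run n t I π w π′ → Run n t′ I′ π w π′
Run-map f []                = []
Run-map f ((_ , i , e) ∷ r) = (proj₁ (f i) , proj₂ (f i) , e) ∷ Run-map f r

Run⇒Seg : ∀ {n t I π w} → Run n t I π w t → Seg n t π w
Run⇒Seg []                  = done
Run⇒Seg ((π≢t , _ , e) ∷ r) = step π≢t e (Run⇒Seg r)

SigmaStep : ℕ → Perm → (Perm → Set) → Perm → Set
SigmaStep n t I π = π ≢ t × I π × π ≢ pathEnd n × ¬ TauCond n π

σ-edge′ : ∀ {n t I π} → SigmaStep n t I π → π ≢ t × I π × Edge n π sig (σ π)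
σ-edge′ (π≢t , i , π≢end , ¬tau) = π≢t , i , σ-edge π≢end ¬tau

σ-run : ∀ {n t I} (u v : List ℕ) →
  (∀ u₁ z u₂ → u ≡ u₁ ++ z ∷ u₂ → SigmaStep n t I (z ∷ u₂ ++ v ++ u₁)) →
  Run n t I (u ++ v) (σ^ (length u)) (v ++ u)
σ-run [] v _ rewrite ++-identityʳ v = []
σ-run {n} {t} {I} (z ∷ u) v ok =
  σ-edge′ {I = I} (subst (SigmaStep n t I) (cong (λ q → z ∷ u ++ q) (++-identityʳ v)) (ok [] z u refl)) ∷
  subst₂ (λ p q → Run n t I p (σ^ (length u)) q) (sym (++-assoc u v [ z ])) (++-assoc v [ z ] u)
    (σ-run u (v ++ [ z ]) λ u₁ z′ u₂ eq →
      subst (λ q → SigmaStep n t I (z′ ∷ u₂ ++ q)) (sym (++-assoc v [ z ] u₁)) (ok (z ∷ u₁) z′ u₂ (cong (z ∷_) eq)))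


-- The segment from ψ̃ to ψ^(n-1)

module Segment (n3 : ℕ) where

  n : ℕ
  n = 3 + n3

  -- The entries of S occur in π in the cyclic order S (which starts with n).
  InCyclicOrder : List ℕ → Perm → Set
  InCyclicOrder S π = rotateTo n (restrict S π) ≡ S

  InCyclicOrder-⊆ : ∀ {T T′ ρ} → n ∉ T′ → (∀ {z} → z ∈ n ∷ T → z ∈ n ∷ T′) → restrict (n ∷ T) T′ ≡ T →
    InCyclicOrder (n ∷ T′) ρ → InCyclicOrder (n ∷ T) ρ
  InCyclicOrder-⊆ {T} {T′} {ρ} n∉T′ ⊆ restrict-T′ ρ-ok
    with rotateTo≡⇒split n T′ (restrict (n ∷ T′) ρ) n∉T′ ρ-ok
  ... | u , v , ρ′≡ , n∉u , _ , v++u≡ = begin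
    rotateTo n (restrict S ρ)                       ≡⟨ cong (rotateTo n) (restrict-restrict S (n ∷ T′) ρ ⊆) ⟨
    rotateTo n (restrict S (restrict (n ∷ T′) ρ))   ≡⟨ cong (rotateTo n ∘ restrict S) ρ′≡ ⟩
    rotateTo n (restrict S (u ++ n ∷ v))            ≡⟨ cong (rotateTo n) (trans (restrict-++ S u (n ∷ v))
                                                         (cong (restrict S u ++_) (restrict-∈ S n v (here refl)))) ⟩
    rotateTo n (restrict S u ++ n ∷ restrict S v)   ≡⟨ rotateTo-split n (restrict S u) (restrict S v) (n∉u ∘ restrict-⊆ S u) ⟩
    n ∷ restrict S v ++ restrict S u                ≡⟨ cong (n ∷_) (trans (sym (restrict-++ S v u)) (cong (restrict S) v++u≡)) ⟩
    n ∷ restrict S T′                               ≡⟨ cong (n ∷_) restrict-T′ ⟩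
    S                                               ∎
    where
    open ≡-Reasoning
    S = n ∷ T

  -- For ψ of height k, the entries n, a_{k+1}, …, a_{n-1}; they keep their cyclic order along W_k.
  anchors : ℕ → List ℕ → List ℕ
  anchors k []       = []
  anchors k (x ∷ xs) = x ∷ drop (k ∸ 1) xs

  SegmentRun : ℕ → List ℕ → Set
  SegmentRun k ψ = Run n (shiftLast n ψ) (InCyclicOrder (anchors k ψ)) (tilde n ψ) (W n k) (shiftLast n ψ)

  ¬TauCond-n-second : ∀ z r → ¬ TauCond n (z ∷ n ∷ r)
  ¬TauCond-n-second z r τ-ok with TauCond⇒seed n z n r τ-ok
  ... | _ , _ , n≡mis , _ = <⇒≢ (⊕1<n n _ (s≤s (s≤s z≤n))) (sym n≡mis)

  module Walk (k0 a2 : ℕ) (P′ : List ℕ) (seed : IsSeed n (n ∷ a2 ∷ P′))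
              (height : Height n (n ∷ a2 ∷ P′) (suc k0)) (k+3<n : suc k0 + 3 < n) where
    P : List ℕ
    P = a2 ∷ P′
    m : ℕ
    m = a2 ⊕1[ n ]
    ψ : List ℕ
    ψ = n ∷ P
    t : Perm
    t = m ∷ P ++ [ n ]
    S : List ℕ
    S = n ∷ drop k0 P
    I : Perm → Set
    I = InCyclicOrder S

    n∉P : n ∉ P
    n∉P = uniq-head (seed-unique seed)
    uP : Unique P
    uP with seed-unique seed
    ... | _ ∷ u = u
    m∉P : m ∉ P
    m∉P = seed-mis∉ seed ∘ there
    m≢n : m ≢ n
    m≢n = seed-mis∉ seed ∘ here
    length-P : length P ≡ suc n3
    length-P = suc-injective (seed-length seed)

    ∈P⇒≢n : ∀ {z} → z ∈ P → z ≢ n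
    ∈P⇒≢n p refl = n∉P p
    ∈P⇒≢m : ∀ {z} → z ∈ P → z ≢ m
    ∈P⇒≢m p refl = m∉P p
    ∈mP⇒≢n : ∀ {z} → z ∈ m ∷ P → z ≢ n
    ∈mP⇒≢n (here refl) = m≢n
    ∈mP⇒≢n (there p)   = ∈P⇒≢n p

    -- Both t and the end of PATH(n) end with n.
    last≢n⇒≢ : ∀ π → lastOr0 π ≢ n → π ≢ t × π ≢ pathEnd n
    last≢n⇒≢ π last≢n = (λ e → last≢n (trans (cong lastOr0 e) (lastOr0-∷ʳ (m ∷ P) n)))
                      , (λ e → last≢n (trans (cong lastOr0 e) (lastOr0-∷ʳ (suc n3 ∷ suc (suc n3) ∷ descending n3) n)))

    restrict-P : restrict S P ≡ drop k0 P
    restrict-P = restrict-drop P n 0 k0 uP n∉P z≤n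

    m∉S : m ∉ S
    m∉S (here e)  = m≢n e
    m∉S (there p) = m∉P (∈-drop⁻ k0 P p)

    -- Rotations of P with m inserted satisfy the invariant, since m ∉ S.
    InCyclicOrder-rotation : ∀ π u v P₁ P₂ → π ≡ u ++ n ∷ v → n ∉ u → n ∉ v →
      v ++ u ≡ P₁ ++ m ∷ P₂ → P₁ ++ P₂ ≡ P → I π
    InCyclicOrder-rotation π u v P₁ P₂ refl n∉u n∉v v++u≡ P≡ = begin
      rotateTo n (restrict S (u ++ n ∷ v))                ≡⟨ cong (rotateTo n) (trans (restrict-++ S u (n ∷ v))
                                                              (cong (restrict S u ++_) (restrict-∈ S n v (here refl)))) ⟩
      rotateTo n (restrict S u ++ n ∷ restrict S v)       ≡⟨ rotateTo-split n (restrict S u) (restrict S v) (n∉u ∘ restrict-⊆ S u) ⟩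
      n ∷ restrict S v ++ restrict S u                    ≡⟨ cong (n ∷_) (begin
        restrict S v ++ restrict S u                        ≡⟨ restrict-++ S v u ⟨
        restrict S (v ++ u)                                 ≡⟨ cong (restrict S) v++u≡ ⟩
        restrict S (P₁ ++ m ∷ P₂)                           ≡⟨ restrict-++ S P₁ (m ∷ P₂) ⟩
        restrict S P₁ ++ restrict S (m ∷ P₂)                ≡⟨ cong (restrict S P₁ ++_) (restrict-∉ S m P₂ m∉S) ⟩
        restrict S P₁ ++ restrict S P₂                      ≡⟨ restrict-++ S P₁ P₂ ⟨
        restrict S (P₁ ++ P₂)                               ≡⟨ cong (restrict S) P≡ ⟩
        restrict S P                                        ≡⟨ restrict-P ⟩
        drop k0 P                                           ∎) ⟩
      S                                                   ∎
      where open ≡-Reasoning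

    ¬TauCond-P-second : ∀ z y r w → y ∈ P → rotateTo n (z ∷ r) ≡ n ∷ a2 ∷ w → ¬ TauCond n (z ∷ y ∷ r)
    ¬TauCond-P-second z y r w y∈P rot τ-ok with TauCond⇒seed n z y r τ-ok
    ... | ψ′ , _ , y≡mis , rot′ with trans (sym rot) rot′
    ... | refl = m∉P (subst (_∈ P) y≡mis y∈P)

    head-a2 : ∀ Q x P₂ → Q ++ x ∷ P₂ ≡ P → ∀ R → Σ (List ℕ) λ w → (Q ++ [ x ]) ++ R ≡ a2 ∷ w
    head-a2 []      x P₂ e R with ∷-injective e
    ... | refl , _ = R , refl
    head-a2 (q ∷ Q) x P₂ e R with ∷-injective e
    ... | refl , _ = (Q ++ [ x ]) ++ R , refl

    module Cut (Q : List ℕ) (x : ℕ) (P₂ : List ℕ) (P≡ : Q ++ x ∷ P₂ ≡ P) where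
      x∈P : x ∈ P
      x∈P = subst (x ∈_) P≡ (∈-++⁺ʳ Q (here refl))
      Q⊆P : ∀ {w} → w ∈ Q → w ∈ P
      Q⊆P p = subst (_ ∈_) P≡ (∈-++⁺ˡ p)
      P₂⊆P : ∀ {w} → w ∈ P₂ → w ∈ P
      P₂⊆P p = subst (_ ∈_) P≡ (∈-++⁺ʳ Q (there p))
      n∉Q : n ∉ Q
      n∉Q p = ∈P⇒≢n (Q⊆P p) refl
      n∉P₂ : n ∉ P₂
      n∉P₂ p = ∈P⇒≢n (P₂⊆P p) refl
      mP₂⊆mP : ∀ {w} → w ∈ m ∷ P₂ → w ∈ m ∷ P
      mP₂⊆mP (here e)  = here e
      mP₂⊆mP (there p) = there (P₂⊆P p)
      P≡′ : (Q ++ [ x ]) ++ P₂ ≡ P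
      P≡′ = trans (++-assoc Q [ x ] P₂) P≡
      n∉xmP₂ : n ∉ x ∷ m ∷ P₂
      n∉xmP₂ (here e)          = ∈P⇒≢n x∈P (sym e)
      n∉xmP₂ (there (here e))  = m≢n (sym e)
      n∉xmP₂ (there (there p)) = n∉P₂ p
      n∉QxmP₂ : n ∉ Q ++ x ∷ m ∷ P₂
      n∉QxmP₂ = ∉-++⁺ n∉Q n∉xmP₂
      length-P≡ : length P ≡ length Q + suc (length P₂)
      length-P≡ = trans (cong length (sym P≡)) (length-++ Q)

      later∈P₂ : ∀ u₁ {z y u₂} → m ∷ P₂ ≡ u₁ ++ z ∷ y ∷ u₂ → y ∈ P₂
      later∈P₂ []        eq = subst (_ ∈_) (sym (proj₂ (∷-injective eq))) (here refl)
      later∈P₂ (_ ∷ u₁) eq = subst (_ ∈_) (sym (proj₂ (∷-injective eq))) (∈-++⁺ʳ u₁ (there (here refl)))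

      ¬TauCond-front : ∀ u₁ z u₂ → m ∷ P₂ ≡ u₁ ++ z ∷ u₂ → ¬ TauCond n (z ∷ u₂ ++ (n ∷ Q ++ [ x ]) ++ u₁)
      ¬TauCond-front u₁ z []       _  = ¬TauCond-n-second z _
      ¬TauCond-front u₁ z (y ∷ u₂) eq =
        ¬TauCond-P-second z y _ (proj₁ a2-first ++ z ∷ u₂) (P₂⊆P (later∈P₂ u₁ eq))
          (trans (rotateTo-split n (z ∷ u₂) ((Q ++ [ x ]) ++ u₁) n∉zu₂)
                 (cong (λ q → n ∷ q ++ z ∷ u₂) (proj₂ a2-first)))
        where
        a2-first = head-a2 Q x P₂ P≡ u₁
        n∉zu₂ : n ∉ z ∷ u₂
        n∉zu₂ (here e)  = ∈mP⇒≢n (mP₂⊆mP (subst (z ∈_) (sym eq) (∈-++⁺ʳ u₁ (here refl)))) (sym e)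
        n∉zu₂ (there p) = ∈mP⇒≢n (mP₂⊆mP (subst (n ∈_) (sym eq) (∈-++⁺ʳ u₁ (there (there p))))) refl

      run-to-front : Run n t I (m ∷ P₂ ++ n ∷ Q ++ [ x ]) (σ^ (suc (length P₂))) (n ∷ Q ++ x ∷ m ∷ P₂)
      run-to-front = subst (Run n t I _ _) (cong (n ∷_) (++-assoc Q [ x ] (m ∷ P₂)))
                       (σ-run (m ∷ P₂) (n ∷ Q ++ [ x ]) step-ok)
        where
        step-ok : ∀ u₁ z u₂ → m ∷ P₂ ≡ u₁ ++ z ∷ u₂ → SigmaStep n t I (z ∷ u₂ ++ (n ∷ Q ++ [ x ]) ++ u₁)
        step-ok u₁ z u₂ eq = π≢t , inv , π≢end , ¬TauCond-front u₁ z u₂ eq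
          where
          π = z ∷ u₂ ++ (n ∷ Q ++ [ x ]) ++ u₁
          ⊆mP : ∀ {w} → w ∈ u₁ ++ z ∷ u₂ → w ∈ m ∷ P
          ⊆mP p = mP₂⊆mP (subst (_ ∈_) (sym eq) p)
          n-after : (n ∷ Q ++ [ x ]) ++ u₁ ≡ n ∷ Q ++ x ∷ u₁
          n-after = cong (n ∷_) (++-assoc Q [ x ] u₁)
          π≡ : π ≡ (z ∷ u₂ ++ n ∷ Q) ++ x ∷ u₁
          π≡ = trans (cong (λ q → z ∷ u₂ ++ q) n-after) (cong (z ∷_) (sym (++-assoc u₂ (n ∷ Q) (x ∷ u₁))))
          last≢n : lastOr0 π ≢ n
          last≢n e with subst (λ q → lastOr0 q ∈ x ∷ u₁) (sym π≡) (lastOr0-∈ (z ∷ u₂ ++ n ∷ Q) x u₁)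
          ... | here e′ = ∈P⇒≢n x∈P (trans (sym e′) e)
          ... | there p = ∈mP⇒≢n (⊆mP (∈-++⁺ˡ p)) e
          π≢t = proj₁ (last≢n⇒≢ π last≢n)
          π≢end = proj₂ (last≢n⇒≢ π last≢n)
          n∉xu₁ : n ∉ x ∷ u₁
          n∉xu₁ (here e)  = ∈P⇒≢n x∈P (sym e)
          n∉xu₁ (there p) = ∈mP⇒≢n (⊆mP (∈-++⁺ˡ p)) refl
          inv : I π
          inv = InCyclicOrder-rotation π (z ∷ u₂) (Q ++ x ∷ u₁) (Q ++ [ x ]) P₂
                  (cong (λ q → z ∷ u₂ ++ q) n-after)
                  (λ p → ∈mP⇒≢n (⊆mP (∈-++⁺ʳ u₁ p)) refl)
                  (∉-++⁺ n∉Q n∉xu₁)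
                  (trans (++-assoc Q (x ∷ u₁) (z ∷ u₂)) (trans (cong (λ q → Q ++ x ∷ q) (sym eq)) (sym (++-assoc Q [ x ] (m ∷ P₂)))))
                  P≡′

      head-a2′ : ∀ u₁ z u₂ R → Q ≡ u₁ ++ z ∷ u₂ → Σ (List ℕ) λ w → u₁ ++ z ∷ R ≡ a2 ∷ w
      head-a2′ []       z u₂ R eq with ∷-injective (trans (cong (_++ x ∷ P₂) (sym eq)) P≡)
      ... | refl , _ = R , refl
      head-a2′ (_ ∷ u₁) z u₂ R eq with ∷-injective (trans (cong (_++ x ∷ P₂) (sym eq)) P≡)
      ... | refl , _ = u₁ ++ z ∷ R , refl

      first-a2-≢pathEnd : ∀ z y r → z ≡ a2 → y ∈ P → z ∷ y ∷ r ≢ pathEnd n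
      first-a2-≢pathEnd z y r z≡a2 y∈P e with ∷-injective e
      ... | z≡ , e′ = ∈P⇒≢m y∈P (trans (proj₁ (∷-injective e′))
                         (sym (trans (cong (_⊕1[ n ]) (trans (sym z≡a2) z≡)) (⊕1-< n (suc n3) (s≤s (s≤s (s≤s ≤-refl)))))))

      ¬TauCond-back : ∀ u₁ z u₂ → Q ≡ u₁ ++ z ∷ u₂ → ¬ TauCond n (z ∷ u₂ ++ (x ∷ m ∷ P₂ ++ [ n ]) ++ u₁)
      ¬TauCond-back u₁ z [] eq = ¬TauCond-P-second z x _ (proj₁ a2-first) x∈P (begin
          rotateTo n (z ∷ m ∷ (P₂ ++ [ n ]) ++ u₁) ≡⟨ cong (λ q → rotateTo n (z ∷ m ∷ q)) (++-assoc P₂ [ n ] u₁) ⟩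
          rotateTo n ((z ∷ m ∷ P₂) ++ n ∷ u₁)       ≡⟨ rotateTo-split n (z ∷ m ∷ P₂) u₁ n∉zmP₂ ⟩
          n ∷ u₁ ++ z ∷ m ∷ P₂                      ≡⟨ cong (n ∷_) (proj₂ a2-first) ⟩
          n ∷ a2 ∷ proj₁ a2-first                   ∎)
        where
        open ≡-Reasoning
        a2-first = head-a2′ u₁ z [] (m ∷ P₂) eq
        n∉zmP₂ : n ∉ z ∷ m ∷ P₂
        n∉zmP₂ (here e)          = n∉Q (subst (_∈ Q) (sym e) (subst (z ∈_) (sym eq) (∈-++⁺ʳ u₁ (here refl))))
        n∉zmP₂ (there (here e))  = m≢n (sym e)
        n∉zmP₂ (there (there p)) = n∉P₂ p
      ¬TauCond-back u₁ z (y ∷ u₂) eq = ¬TauCond-P-second z y _ (proj₁ a2-first) (Q⊆P (inQ (there (here refl)))) (begin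
          rotateTo n (z ∷ u₂ ++ (x ∷ m ∷ P₂ ++ [ n ]) ++ u₁) ≡⟨ cong (rotateTo n) rearrange ⟩
          rotateTo n ((z ∷ u₂ ++ x ∷ m ∷ P₂) ++ n ∷ u₁)       ≡⟨ rotateTo-split n (z ∷ u₂ ++ x ∷ m ∷ P₂) u₁ n∉ ⟩
          n ∷ u₁ ++ z ∷ u₂ ++ x ∷ m ∷ P₂                      ≡⟨ cong (n ∷_) (proj₂ a2-first) ⟩
          n ∷ a2 ∷ proj₁ a2-first                             ∎)
        where
        open ≡-Reasoning
        a2-first = head-a2′ u₁ z (y ∷ u₂) (u₂ ++ x ∷ m ∷ P₂) eq
        inQ : ∀ {w} → w ∈ z ∷ y ∷ u₂ → w ∈ Q
        inQ p = subst (_ ∈_) (sym eq) (∈-++⁺ʳ u₁ p)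
        rearrange : z ∷ u₂ ++ (x ∷ m ∷ P₂ ++ [ n ]) ++ u₁ ≡ (z ∷ u₂ ++ x ∷ m ∷ P₂) ++ n ∷ u₁
        rearrange = trans (cong (λ q → z ∷ u₂ ++ x ∷ m ∷ q) (++-assoc P₂ [ n ] u₁))
                          (cong (z ∷_) (sym (++-assoc u₂ (x ∷ m ∷ P₂) (n ∷ u₁))))
        n∉ : n ∉ z ∷ u₂ ++ x ∷ m ∷ P₂
        n∉ (here e)  = n∉Q (inQ (here e))
        n∉ (there p) = ∉-++⁺ (n∉Q ∘ inQ ∘ there ∘ there) n∉xmP₂ p

      ≢pathEnd-back : ∀ u₁ z u₂ → Q ≡ u₁ ++ z ∷ u₂ → z ∷ u₂ ++ (x ∷ m ∷ P₂ ++ [ n ]) ++ u₁ ≢ pathEnd n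
      ≢pathEnd-back [] z [] eq =
        first-a2-≢pathEnd z x _ (proj₁ (∷-injective (proj₂ (head-a2′ [] z [] [] eq)))) x∈P
      ≢pathEnd-back [] z (y ∷ u₂) eq =
        first-a2-≢pathEnd z y _ (proj₁ (∷-injective (proj₂ (head-a2′ [] z (y ∷ u₂) [] eq))))
          (Q⊆P (subst (y ∈_) (sym eq) (there (here refl))))
      ≢pathEnd-back (y ∷ u₁) z u₂ eq = proj₂ (last≢n⇒≢ π last≢n)
        where
        π = z ∷ u₂ ++ (x ∷ m ∷ P₂ ++ [ n ]) ++ y ∷ u₁
        π≡ : π ≡ (z ∷ u₂ ++ x ∷ m ∷ P₂ ++ [ n ]) ++ y ∷ u₁
        π≡ = cong (z ∷_) (sym (++-assoc u₂ (x ∷ m ∷ P₂ ++ [ n ]) (y ∷ u₁)))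
        last≢n : lastOr0 π ≢ n
        last≢n e = n∉Q (subst (_ ∈_) (sym eq) (∈-++⁺ˡ (subst (_∈ y ∷ u₁) e
                     (subst (λ q → lastOr0 q ∈ y ∷ u₁) (sym π≡) (lastOr0-∈ (z ∷ u₂ ++ x ∷ m ∷ P₂ ++ [ n ]) y u₁)))))

      run-to-back : Run n t I (Q ++ x ∷ m ∷ P₂ ++ [ n ]) (σ^ (length Q)) (x ∷ m ∷ P₂ ++ n ∷ Q)
      run-to-back = subst (Run n t I _ _) (cong (λ q → x ∷ m ∷ q) (++-assoc P₂ [ n ] Q))
                      (σ-run Q (x ∷ m ∷ P₂ ++ [ n ]) step-ok)
        where
        step-ok : ∀ u₁ z u₂ → Q ≡ u₁ ++ z ∷ u₂ → SigmaStep n t I (z ∷ u₂ ++ (x ∷ m ∷ P₂ ++ [ n ]) ++ u₁)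
        step-ok u₁ z u₂ eq = π≢t , inv , ≢pathEnd-back u₁ z u₂ eq , ¬TauCond-back u₁ z u₂ eq
          where
          π = z ∷ u₂ ++ (x ∷ m ∷ P₂ ++ [ n ]) ++ u₁
          inQ : ∀ {w} → w ∈ u₁ ++ z ∷ u₂ → w ∈ Q
          inQ p = subst (_ ∈_) (sym eq) p
          z∈Q : z ∈ Q
          z∈Q = inQ (∈-++⁺ʳ u₁ (here refl))
          π≢t : π ≢ t
          π≢t e = ∈P⇒≢m (Q⊆P z∈Q) (proj₁ (∷-injective e))
          π≡ : π ≡ (z ∷ u₂ ++ x ∷ m ∷ P₂) ++ n ∷ u₁
          π≡ = trans (cong (λ q → z ∷ u₂ ++ x ∷ m ∷ q) (++-assoc P₂ [ n ] u₁))
                     (cong (z ∷_) (sym (++-assoc u₂ (x ∷ m ∷ P₂) (n ∷ u₁))))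
          n∉ : n ∉ z ∷ u₂ ++ x ∷ m ∷ P₂
          n∉ (here e)  = n∉Q (subst (_∈ Q) (sym e) z∈Q)
          n∉ (there p) = ∉-++⁺ (n∉Q ∘ inQ ∘ ∈-++⁺ʳ u₁ ∘ there) n∉xmP₂ p
          inv : I π
          inv = InCyclicOrder-rotation π (z ∷ u₂ ++ x ∷ m ∷ P₂) u₁ (Q ++ [ x ]) P₂ π≡ n∉
                  (n∉Q ∘ inQ ∘ ∈-++⁺ˡ)
                  (trans (sym (++-assoc u₁ (z ∷ u₂) (x ∷ m ∷ P₂)))
                    (trans (cong (_++ x ∷ m ∷ P₂) (sym eq)) (sym (++-assoc Q [ x ] (m ∷ P₂)))))
                  P≡′

      -- x ∷ m ∷ P₂ ++ n ∷ Q is ψ with m inserted after x, rotated by |n ∷ Q|.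
      TauCond-swap : TauCond n (x ∷ m ∷ P₂ ++ n ∷ Q)
      TauCond-swap = ψ , seed , (suc (suc (length Q)) , suc (length Q) , i≤ , j<n , π≡) , (x , P₂ ++ n ∷ Q , refl)
        where
        1+Q≤P : suc (length Q) ≤ length P
        1+Q≤P = subst (_≤ length P) (+-comm (length Q) 1)
                  (subst (length Q + 1 ≤_) (sym length-P≡) (+-monoʳ-≤ (length Q) (s≤s z≤n)))
        i≤ : suc (suc (length Q)) ≤ length ψ
        i≤ = s≤s 1+Q≤P
        j<n : suc (length Q) < n
        j<n = s≤s (≤-trans (subst (suc (length Q) ≤_) length-P 1+Q≤P) (n≤1+n (suc n3)))
        π≡ : x ∷ m ∷ P₂ ++ n ∷ Q ≡ rotate (suc (length Q)) (insertAt (suc (suc (length Q))) m ψ)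
        π≡ = sym (begin
          rotate (suc (length Q)) (n ∷ take (suc (length Q)) P ++ m ∷ drop (suc (length Q)) P)
            ≡⟨ cong (λ L → rotate (suc (length Q)) (n ∷ take (suc (length Q)) L ++ m ∷ drop (suc (length Q)) L)) P≡ ⟨
          rotate (suc (length Q)) (n ∷ take (suc (length Q)) (Q ++ x ∷ P₂) ++ m ∷ drop (suc (length Q)) (Q ++ x ∷ P₂))
            ≡⟨ cong₂ (λ A B → rotate (suc (length Q)) (n ∷ A ++ m ∷ B)) (take-suc-length Q x P₂) (drop-suc-length Q x P₂) ⟩
          rotate (suc (length Q)) (n ∷ (Q ++ [ x ]) ++ m ∷ P₂)
            ≡⟨ cong (λ L → rotate (suc (length Q)) (n ∷ L)) (++-assoc Q [ x ] (m ∷ P₂)) ⟩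
          rotate (length (n ∷ Q)) ((n ∷ Q) ++ x ∷ m ∷ P₂)
            ≡⟨ rotate-length-++ (n ∷ Q) (x ∷ m ∷ P₂) ⟩
          x ∷ m ∷ P₂ ++ n ∷ Q ∎)
          where open ≡-Reasoning

      run-swap : Run n t I (x ∷ m ∷ P₂ ++ n ∷ Q) [ tau ] (m ∷ x ∷ P₂ ++ n ∷ Q)
      run-swap = (π≢t , inv , τ-edge (π≢end Q refl) π≢π₀ TauCond-swap) ∷ []
        where
        π = x ∷ m ∷ P₂ ++ n ∷ Q
        π≢t : π ≢ t
        π≢t e = ∈P⇒≢m x∈P (proj₁ (∷-injective e))
        π≢π₀ : π ≢ π₀ n
        π≢π₀ e = ∈P⇒≢n x∈P (proj₁ (∷-injective e))
        inv : I π
        inv = InCyclicOrder-rotation π (x ∷ m ∷ P₂) Q (Q ++ [ x ]) P₂ refl n∉xmP₂ n∉Q (sym (++-assoc Q [ x ] (m ∷ P₂))) P≡′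
        π≢end : ∀ Q′ → Q′ ≡ Q → π ≢ pathEnd n
        π≢end [] refl e with ∷-injective e
        ... | e₁ , e₂ = Height⇒tail≢descending n3 (suc k0) P k+3<n height
                          (trans (sym P≡) (cong₂ _∷_ e₁ (∷ʳ-injectiveˡ P₂ (descending n3) (proj₂ (∷-injective e₂)))))
        π≢end (q ∷ Q′) refl = proj₂ (last≢n⇒≢ π last≢n)
          where
          π≡ : π ≡ (x ∷ m ∷ P₂ ++ [ n ]) ++ q ∷ Q′
          π≡ = cong (λ z → x ∷ m ∷ z) (sym (++-assoc P₂ [ n ] (q ∷ Q′)))
          last≢n : lastOr0 π ≢ n
          last≢n e = n∉Q (subst (_∈ q ∷ Q′) e (subst (λ z → lastOr0 z ∈ q ∷ Q′) (sym π≡) (lastOr0-∈ (x ∷ m ∷ P₂ ++ [ n ]) q Q′)))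

      run-σ : ¬ TauCond n (n ∷ Q ++ x ∷ m ∷ P₂) → Run n t I (n ∷ Q ++ x ∷ m ∷ P₂) [ sig ] (Q ++ x ∷ m ∷ P₂ ++ [ n ])
      run-σ ¬τ = (π≢t , inv , σ-edge π≢end ¬τ) ∷ subst (Run n t I _ []) (++-assoc Q (x ∷ m ∷ P₂) [ n ]) []
        where
        π = n ∷ Q ++ x ∷ m ∷ P₂
        π≢t : π ≢ t
        π≢t e = m≢n (sym (proj₁ (∷-injective e)))
        π≢end : π ≢ pathEnd n
        π≢end e = <-irrefl (sym (proj₁ (∷-injective e))) (n≤1+n (suc (suc n3)))
        inv : I π
        inv = InCyclicOrder-rotation π [] (Q ++ x ∷ m ∷ P₂) (Q ++ [ x ]) P₂ refl (λ ()) n∉QxmP₂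
                (trans (++-identityʳ _) (sym (++-assoc Q [ x ] (m ∷ P₂)))) P≡′

    1≤a2 : 1 ≤ a2
    1≤a2 = proj₁ (All.lookup (seed-bounds seed) (there (here refl)))
    a2<n-1 : a2 ≤ 2 + n3
    a2<n-1 = ≤-pred (≤∧≢⇒< (proj₂ (All.lookup (seed-bounds seed) (there (here refl)))) (∈P⇒≢n (here refl)))
    chain : TailChain P n (suc k0)
    chain = Chain⇒TailChain {n = n} (proj₁ (proj₂ height))
    maximal : ∀ k′ → suc k0 < k′ → k′ ≤ suc n3 → ¬ Chain ψ n k′
    maximal = proj₂ (proj₂ height)
    k<n3 : suc k0 < n3
    k<n3 = ≤-pred (≤-pred (≤-pred (subst (_< n) (+-comm (suc k0) 3) k+3<n)))

    ¬TauCond-first-empty : ∀ x P₂ → x ∷ P₂ ≡ P → ¬ TauCond n (n ∷ x ∷ m ∷ P₂)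
    ¬TauCond-first-empty x P₂ P≡ τ-ok with TauCond⇒seed n n x (m ∷ P₂) τ-ok | ∷-injective P≡
    ... | ψ′ , _ , x≡mis , rot | refl , _ =
      ⊕-≢ (2 + n3) a2 2 1≤a2 a2<n-1 (s≤s z≤n) (+-monoʳ-< 2 (≤-trans (s≤s z≤n) k<n3))
        (sym (trans x≡mis (cong (mis n) (trans (sym rot) (rotateTo-split n [] (m ∷ P₂) (λ ()))))))

    -- For height 1, a τ-edge here would make a2 = a3 ⊕ 1, i.e. height at least 2.
    ¬TauCond-height1 : k0 ≡ 0 → ∀ Q x P₂ → a2 ∷ Q ++ x ∷ P₂ ≡ P → ¬ TauCond n (n ∷ a2 ∷ Q ++ x ∷ m ∷ P₂)
    ¬TauCond-height1 refl Q x P₂ P≡ τ-ok with TauCond⇒seed n n a2 (Q ++ x ∷ m ∷ P₂) τ-ok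
    ... | ψ′ , _ , a2≡mis , rot =
      maximal 2 ≤-refl (s≤s (≤-trans (s≤s z≤n) k<n3)) (TailChain⇒Chain {n = n} {k = 2} chain₂)
      where
      L = Q ++ x ∷ m ∷ P₂
      a2≡ : a2 ≡ at L 0 ⊕1[ n ]
      a2≡ = trans a2≡mis (cong (mis n) (trans (sym rot) (trans (rotateTo-split n [] L (λ ())) (cong (n ∷_) (++-identityʳ L)))))
      chain₂ : TailChain P n 2
      chain₂ zero    _ = trans a2≡ (cong (_⊕1[ n ]) (trans (at-≡-prefix Q x (m ∷ P₂) P₂ 0 z≤n)
                                                          (cong (λ L → at L 0) (proj₂ (∷-injective P≡)))))
      chain₂ (suc i) (s≤s (s≤s ()))

    run-start : Run n t I (n ∷ m ∷ P) [ tau ] (m ∷ n ∷ P)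
    run-start = (π≢t , inv , τ-edge π≢end π≢π₀ τ-ok) ∷ []
      where
      π = n ∷ m ∷ P
      π≢t : π ≢ t
      π≢t e = m≢n (sym (proj₁ (∷-injective e)))
      π≢end : π ≢ pathEnd n
      π≢end e = <-irrefl (sym (proj₁ (∷-injective e))) (n≤1+n (suc (suc n3)))
      π≢π₀ : π ≢ π₀ n
      π≢π₀ e = Height⇒tail≢descending n3 (suc k0) P k+3<n height (proj₂ (∷-injective (proj₂ (∷-injective e))))
      inv : I π
      inv = InCyclicOrder-rotation π [] (m ∷ P) [] P refl (λ ()) (∉-∷⁺ (m≢n ∘ sym) n∉P) (++-identityʳ _) refl
      τ-ok : TauCond n π
      τ-ok = ψ , seed , (1 , 0 , s≤s z≤n , s≤s z≤n , sym (++-identityʳ _)) , (n , P , refl)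

    block : ℕ → List Gen
    block i = σ^ i ++ Wf n (suc k0) (k0 ⊓ (n ∸ 2 ∸ i)) ++ γ (n ∸ 2 ∸ i)

    InnerRuns : Set
    InnerRuns = ∀ Q x P₂ → Q ++ x ∷ P₂ ≡ P →
      Run n t I (n ∷ Q ++ x ∷ m ∷ P₂) (Wf n (suc k0) (k0 ⊓ length Q)) (Q ++ x ∷ m ∷ P₂ ++ [ n ])

    module _ (inner : InnerRuns) where

      run-block : ∀ Q x P₂ → Q ++ x ∷ P₂ ≡ P →
        Run n t I (m ∷ P₂ ++ n ∷ Q ++ [ x ]) (block (suc (length P₂))) (m ∷ x ∷ P₂ ++ n ∷ Q)
      run-block Q x P₂ P≡ = subst (λ w → Run n t I (m ∷ P₂ ++ n ∷ Q ++ [ x ]) w (m ∷ x ∷ P₂ ++ n ∷ Q))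
          (cong (λ q → σ^ (suc (length P₂)) ++ Wf n (suc k0) (k0 ⊓ q) ++ γ q) (sym n-2-i≡Q))
          (run-to-front ++ʳ inner Q x P₂ P≡ ++ʳ run-to-back ++ʳ run-swap)
        where
        open Cut Q x P₂ P≡
        n-2-i≡Q : n ∸ 2 ∸ suc (length P₂) ≡ length Q
        n-2-i≡Q = trans (cong (_∸ suc (length P₂)) (trans (sym length-P) length-P≡)) (m+n∸n≡m (length Q) (suc (length P₂)))

      run-blocks : ∀ P₂ Q → Q ++ P₂ ≡ P →
        Run n t I (m ∷ n ∷ P) (concatMap block (map suc (upTo (length P₂)))) (m ∷ P₂ ++ n ∷ Q)
      run-blocks []       Q P≡ = subst (λ q → Run n t I (m ∷ n ∷ P) [] (m ∷ n ∷ q)) (sym (trans (sym (++-identityʳ Q)) P≡)) []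
      run-blocks (x ∷ P₂) Q P≡ = subst (λ w → Run n t I (m ∷ n ∷ P) w (m ∷ x ∷ P₂ ++ n ∷ Q)) (sym blocks-∷ʳ)
          (run-blocks P₂ (Q ++ [ x ]) (trans (++-assoc Q [ x ] P₂) P≡) ++ʳ run-block Q x P₂ P≡)
        where
        l = length P₂
        blocks-∷ʳ : concatMap block (map suc (upTo (suc l))) ≡ concatMap block (map suc (upTo l)) ++ block (suc l)
        blocks-∷ʳ = begin
          concatMap block (map suc (upTo (suc l)))             ≡⟨ cong (concatMap block ∘ map suc) (upTo-∷ʳ l) ⟨
          concatMap block (map suc (upTo l ++ [ l ]))          ≡⟨ cong (concatMap block) (map-++ suc (upTo l) [ l ]) ⟩
          concatMap block (map suc (upTo l) ++ [ suc l ])      ≡⟨ concatMap-++ block (map suc (upTo l)) [ suc l ] ⟩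
          concatMap block (map suc (upTo l)) ++ block (suc l) ++ [] ≡⟨ cong (concatMap block (map suc (upTo l)) ++_) (++-identityʳ _) ⟩
          concatMap block (map suc (upTo l)) ++ block (suc l) ∎
          where open ≡-Reasoning

      run-segment : Run n t I (n ∷ m ∷ P) (W n (suc k0)) t
      run-segment = run-start ++ʳ subst (λ q → Run n t I (m ∷ n ∷ P) (concatMap block (map suc (upTo q))) t) length-P
                                        (run-blocks P [] refl)

    inner-run-σ : ∀ Q x P₂ (P≡ : Q ++ x ∷ P₂ ≡ P) → ¬ TauCond n (n ∷ Q ++ x ∷ m ∷ P₂) → Wf n (suc k0) (k0 ⊓ length Q) ≡ [ sig ] →
      Run n t I (n ∷ Q ++ x ∷ m ∷ P₂) (Wf n (suc k0) (k0 ⊓ length Q)) (Q ++ x ∷ m ∷ P₂ ++ [ n ])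
    inner-run-σ Q x P₂ P≡ ¬τ w≡σ = subst (λ w → Run n t I (n ∷ Q ++ x ∷ m ∷ P₂) w (Q ++ x ∷ m ∷ P₂ ++ [ n ])) (sym w≡σ) (Cut.run-σ Q x P₂ P≡ ¬τ)

    inner-run-first : ∀ x P₂ (P≡ : x ∷ P₂ ≡ P) →
      Run n t I (n ∷ x ∷ m ∷ P₂) (Wf n (suc k0) (k0 ⊓ 0)) (x ∷ m ∷ P₂ ++ [ n ])
    inner-run-first x P₂ P≡ = inner-run-σ [] x P₂ P≡ (¬TauCond-first-empty x P₂ P≡) (cong (Wf n (suc k0)) (⊓-zeroʳ k0))

    inner-runs-height1 : k0 ≡ 0 → InnerRuns
    inner-runs-height1 k0≡0 []      x P₂ P≡ = inner-run-first x P₂ P≡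
    inner-runs-height1 refl (q ∷ Q) x P₂ P≡ with ∷-injective P≡
    ... | refl , _ = inner-run-σ (a2 ∷ Q) x P₂ P≡ (¬TauCond-height1 refl Q x P₂ P≡) refl

  module Recursive (k1 a2 : ℕ) (P′ : List ℕ) (seed : IsSeed n (n ∷ a2 ∷ P′))
                   (height : Height n (n ∷ a2 ∷ P′) (suc (suc k1))) (k+3<n : suc (suc k1) + 3 < n)
                   (IH : ∀ k′ ψ′ → 1 ≤ k′ → k′ ≤ suc k1 → IsSeed n ψ′ → Height n ψ′ k′ → SegmentRun k′ ψ′) where
    open Walk (suc k1) a2 P′ seed height k+3<n

    -- The inner segment of a block is W_{d+1} of the seed n ∷ Q′ ++ x ∷ m ∷ P₂ obtained by moving m
    -- behind x; its missing element is a2 and its height is d + 1.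
    module Inner (Q′ : List ℕ) (x : ℕ) (P₂ : List ℕ) (P′≡ : Q′ ++ x ∷ P₂ ≡ P′) where
      open Cut (a2 ∷ Q′) x P₂ (cong (a2 ∷_) P′≡)

      d : ℕ
      d = k1 ⊓ length Q′
      L′ : List ℕ
      L′ = Q′ ++ x ∷ m ∷ P₂
      ψ′ : List ℕ
      ψ′ = n ∷ L′
      S′ : List ℕ
      S′ = n ∷ drop d L′

      d≤Q′ : d ≤ length Q′
      d≤Q′ = m⊓n≤n k1 (length Q′)
      d≤k1 : d ≤ k1
      d≤k1 = m⊓n≤m k1 (length Q′)
      uP′ : Unique P′
      uP′ with uP
      ... | _ ∷ u = u
      n∉P′ : n ∉ P′
      n∉P′ = n∉P ∘ there
      a2∉P′ : a2 ∉ P′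
      a2∉P′ = uniq-head uP

      ∈L′⇒ : ∀ {z} → z ∈ L′ → z ≡ m ⊎ z ∈ P′
      ∈L′⇒ p with ∈-++⁻ Q′ p
      ... | inj₁ q                = inj₂ (subst (_ ∈_) P′≡ (∈-++⁺ˡ q))
      ... | inj₂ (here e)         = inj₂ (subst (_ ∈_) P′≡ (∈-++⁺ʳ Q′ (here e)))
      ... | inj₂ (there (here e)) = inj₁ e
      ... | inj₂ (there (there q)) = inj₂ (subst (_ ∈_) P′≡ (∈-++⁺ʳ Q′ (there q)))

      ∈P′⇒ : ∀ {z} → z ∈ P′ → z ∈ L′
      ∈P′⇒ p with ∈-++⁻ Q′ (subst (_ ∈_) (sym P′≡) p)
      ... | inj₁ q         = ∈-++⁺ˡ q
      ... | inj₂ (here e)  = ∈-++⁺ʳ Q′ (here e)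
      ... | inj₂ (there q) = ∈-++⁺ʳ Q′ (there (there q))

      at-L′ : ∀ j → j ≤ length Q′ → at L′ j ≡ at P (suc j)
      at-L′ j j≤Q′ = trans (at-≡-prefix Q′ x (m ∷ P₂) P₂ j j≤Q′) (cong (λ z → at z j) P′≡)

      mis-ψ′ : mis n ψ′ ≡ a2
      mis-ψ′ = trans (cong (_⊕1[ n ]) (at-L′ 0 z≤n)) (sym (chain 0 (s≤s (s≤s z≤n))))

      length-L′ : length L′ ≡ suc n3
      length-L′ = begin
        length (Q′ ++ x ∷ m ∷ P₂)        ≡⟨ length-++ Q′ ⟩
        length Q′ + suc (suc (length P₂)) ≡⟨ +-suc (length Q′) (suc (length P₂)) ⟩
        suc (length Q′ + suc (length P₂)) ≡⟨ cong suc (sym (length-++ Q′)) ⟩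
        suc (length (Q′ ++ x ∷ P₂))       ≡⟨ cong (suc ∘ length) P′≡ ⟩
        suc (length P′)                   ≡⟨ length-P ⟩
        suc n3                            ∎
        where open ≡-Reasoning

      unique-L′ : Unique L′
      unique-L′ = subst Unique (++-assoc Q′ [ x ] (m ∷ P₂))
                    (uniq-insert (Q′ ++ [ x ]) (subst Unique (sym (trans (++-assoc Q′ [ x ] P₂) P′≡)) uP′)
                      (λ p → m∉P (there (subst (m ∈_) (trans (++-assoc Q′ [ x ] P₂) P′≡) p))))

      n∉L′ : n ∉ L′
      n∉L′ p with ∈L′⇒ p
      ... | inj₁ e = m≢n (sym e)
      ... | inj₂ q = n∉P′ q

      a2∉ψ′ : a2 ∉ ψ′
      a2∉ψ′ (here e)  = ∈P⇒≢n (here refl) e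
      a2∉ψ′ (there p) with ∈L′⇒ p
      ... | inj₁ e = ∈P⇒≢m (here refl) e
      ... | inj₂ q = a2∉P′ q

      bounds′ : All (λ z → 1 ≤ z × z ≤ n) ψ′
      bounds′ = All.tabulate bound
        where
        bound : ∀ {z} → z ∈ ψ′ → 1 ≤ z × z ≤ n
        bound (here refl) = s≤s z≤n , ≤-refl
        bound (there p) with ∈L′⇒ p
        ... | inj₁ refl = 1≤⊕1 n a2 , <⇒≤ (⊕1<n n a2 (s≤s (s≤s z≤n)))
        ... | inj₂ q    = All.lookup (seed-bounds seed) (there (there q))

      missing′ : ∀ z → 1 ≤ z → z ≤ n → z ∉ ψ′ → z ≡ mis n ψ′
      missing′ z 1≤z z≤top z∉ψ′ with z ≟ a2
      ... | yes z≡a2 = trans z≡a2 (sym mis-ψ′)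
      ... | no  z≢a2 = ⊥-elim (z∉ψ′ (subst (_∈ ψ′) (sym (seed-missing seed z 1≤z z≤top z∉ψ)) (there m∈L′)))
        where
        m∈L′ : m ∈ L′
        m∈L′ = ∈-++⁺ʳ Q′ (there (here refl))
        z∉ψ : z ∉ ψ
        z∉ψ (here e)          = z∉ψ′ (here e)
        z∉ψ (there (here e))  = z≢a2 e
        z∉ψ (there (there q)) = z∉ψ′ (there (∈P′⇒ q))

      seed′ : IsSeed n ψ′
      seed′ = cong suc length-L′ , (All.tabulate (λ p e → n∉L′ (subst (_∈ L′) (sym e) p)) ∷ unique-L′) , bounds′ , (L′ , refl) ,
              subst (λ c → 1 ≤ c × c ≤ n × c ∉ ψ′) (sym mis-ψ′) (1≤a2 , <⇒≤ (s≤s a2<n-1) , a2∉ψ′) , missing′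

      chain′ : TailChain L′ n (suc d)
      chain′ i 2+i≤ = begin
        at L′ i                       ≡⟨ at-L′ i (≤-trans (n≤1+n i) (≤-trans i<d d≤Q′)) ⟩
        at P (suc i)                  ≡⟨ chain (suc i) (s≤s (s≤s (≤-trans i<d d≤k1))) ⟩
        at P (suc (suc i)) ⊕1[ n ]    ≡⟨ cong (_⊕1[ n ]) (at-L′ (suc i) (≤-trans i<d d≤Q′)) ⟨
        at L′ (suc i) ⊕1[ n ]         ∎
        where
        open ≡-Reasoning
        i<d : suc i ≤ d
        i<d = ≤-pred 2+i≤

      -- A longer chain in ψ′ either extends the chain of ψ (when d = k1) or closes a cycle of
      -- length d + 3 < n − 1 through m = a2 ⊕ 1 (when d = |Q′|).
      maximal′ : ∀ k′ → suc d < k′ → k′ ≤ suc n3 → ¬ Chain ψ′ n k′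
      maximal′ k′ d<k′ k′≤ ch with m≤n⇒m<n∨m≡n d≤Q′
      ... | inj₁ d<Q′ = maximal (3 + k1) ≤-refl (≤-trans k<n3 (n≤1+n n3)) (TailChain⇒Chain {n = n} {k = 3 + k1} chain₃)
        where
        d≡k1 : d ≡ k1
        d≡k1 with ≤-total k1 (length Q′)
        ... | inj₁ k1≤Q′ = m≤n⇒m⊓n≡m k1≤Q′
        ... | inj₂ Q′≤k1 = ⊥-elim (<-irrefl (m≥n⇒m⊓n≡n Q′≤k1) d<Q′)
        step-d : at P (suc d) ≡ at P (suc (suc d)) ⊕1[ n ]
        step-d = trans (sym (at-L′ d d≤Q′)) (trans (Chain⇒TailChain {n = n} ch d d<k′) (cong (_⊕1[ n ]) (at-L′ (suc d) d<Q′)))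
        chain₃ : TailChain P n (3 + k1)
        chain₃ i 2+i≤ with m≤n⇒m<n∨m≡n 2+i≤
        ... | inj₁ 2+i<3+k1 = chain i (≤-pred 2+i<3+k1)
        ... | inj₂ 2+i≡3+k1 = subst (λ j → at P j ≡ at P (suc j) ⊕1[ n ]) (trans (cong suc d≡k1) (sym (suc-injective (suc-injective 2+i≡3+k1)))) step-d
      ... | inj₂ d≡Q′ = ⊕-≢ (2 + n3) m (3 + d) (1≤⊕1 n a2) (≤-pred (⊕1<n n a2 (s≤s (s≤s z≤n)))) (s≤s z≤n) 3+d<n-1 (sym m≡m⊕3+d)
        where
        at-m : at L′ (suc d) ≡ m
        at-m = subst (λ j → at L′ (suc j) ≡ m) (sym d≡Q′) (at-after Q′ x m P₂)
        a3≡ : at P (suc d) ≡ m ⊕1[ n ]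
        a3≡ = trans (sym (at-L′ d d≤Q′)) (trans (Chain⇒TailChain {n = n} ch d d<k′) (cong (_⊕1[ n ]) at-m))
        a2≡ : a2 ≡ at P (suc d) ⊕[ n ] suc d
        a2≡ = TailChain⇒⊕ n P (suc d) (λ i i<1+d → chain i (s≤s (s≤s (≤-trans (≤-pred i<1+d) d≤k1))))
        m≡m⊕3+d : m ≡ m ⊕[ n ] (3 + d)
        m≡m⊕3+d = cong (_⊕1[ n ]) (trans a2≡ (trans (cong (_⊕[ n ] suc d) a3≡) (⊕1-⊕ n m (suc d))))
        3+d<n-1 : 3 + d < 2 + n3
        3+d<n-1 = ≤-trans (s≤s (s≤s (s≤s (s≤s d≤k1)))) (≤-trans (s≤s k<n3) (n≤1+n (suc n3)))

      height′ : Height n ψ′ (suc d)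
      height′ = (s≤s z≤n , s≤s (≤-trans d≤k1 (≤-trans (m≤n+m k1 3) k<n3))) , TailChain⇒Chain {n = n} chain′ , maximal′

      drop-L′ : drop d L′ ≡ drop d Q′ ++ x ∷ m ∷ P₂
      drop-L′ = drop-++ˡ d Q′ (x ∷ m ∷ P₂) d≤Q′
      drop-P′ : drop d P′ ≡ drop d Q′ ++ x ∷ P₂
      drop-P′ = trans (cong (drop d) (sym P′≡)) (drop-++ˡ d Q′ (x ∷ P₂) d≤Q′)

      m∈S′ : m ∈ S′
      m∈S′ = there (subst (m ∈_) (sym drop-L′) (∈-++⁺ʳ (drop d Q′) (there (here refl))))

      -- In S′ the entry following n lies in P, whereas in t it is m.
      InCyclicOrder′⇒≢t : ∀ {ρ} → InCyclicOrder S′ ρ → ρ ≢ t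
      InCyclicOrder′⇒≢t ρ-ok refl = second-not-m (drop d Q′) (Q⊆P ∘ there ∘ ∈-drop⁻ d Q′) (trans (sym drop-L′) (sym (proj₂ (∷-injective rot-t))))
        where
        restrict-t : restrict S′ t ≡ (m ∷ restrict S′ P) ++ n ∷ []
        restrict-t = trans (restrict-∈ S′ m (P ++ [ n ]) m∈S′)
                       (cong (m ∷_) (trans (restrict-++ S′ P [ n ]) (cong (restrict S′ P ++_) (restrict-∈ S′ n [] (here refl)))))
        n∉ : n ∉ m ∷ restrict S′ P
        n∉ (here e)  = m≢n (sym e)
        n∉ (there p) = n∉P (restrict-⊆ S′ P p)
        rot-t : n ∷ m ∷ restrict S′ P ≡ n ∷ drop d L′
        rot-t = trans (sym (rotateTo-split n (m ∷ restrict S′ P) [] n∉)) (trans (cong (rotateTo n) (sym restrict-t)) ρ-ok)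
        second-not-m : ∀ Y {W} → (∀ {w} → w ∈ Y → w ∈ P) → Y ++ x ∷ m ∷ P₂ ≢ m ∷ W
        second-not-m []      _   e = ∈P⇒≢m x∈P (proj₁ (∷-injective e))
        second-not-m (y ∷ Y) Y⊆P e = ∈P⇒≢m (Y⊆P (here refl)) (proj₁ (∷-injective e))

      S⊆S′ : ∀ {z} → z ∈ S → z ∈ S′
      S⊆S′ (here e)  = here e
      S⊆S′ (there p) with ∈-++⁻ (drop d Q′) (subst (_ ∈_) drop-P′ (∈-drop-mono d k1 P′ d≤k1 p))
      ... | inj₁ q         = there (subst (_ ∈_) (sym drop-L′) (∈-++⁺ˡ q))
      ... | inj₂ (here e)  = there (subst (_ ∈_) (sym drop-L′) (∈-++⁺ʳ (drop d Q′) (here e)))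
      ... | inj₂ (there q) = there (subst (_ ∈_) (sym drop-L′) (∈-++⁺ʳ (drop d Q′) (there (there q))))

      restrict-drop-L′ : restrict S (drop d L′) ≡ drop k1 P′
      restrict-drop-L′ = begin
        restrict S (drop d L′)                                ≡⟨ cong (restrict S) (trans drop-L′ (sym (++-assoc (drop d Q′) [ x ] (m ∷ P₂)))) ⟩
        restrict S ((drop d Q′ ++ [ x ]) ++ m ∷ P₂)           ≡⟨ restrict-++ S (drop d Q′ ++ [ x ]) (m ∷ P₂) ⟩
        restrict S (drop d Q′ ++ [ x ]) ++ restrict S (m ∷ P₂) ≡⟨ cong (restrict S (drop d Q′ ++ [ x ]) ++_) (restrict-∉ S m P₂ m∉S) ⟩
        restrict S (drop d Q′ ++ [ x ]) ++ restrict S P₂      ≡⟨ restrict-++ S (drop d Q′ ++ [ x ]) P₂ ⟨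
        restrict S ((drop d Q′ ++ [ x ]) ++ P₂)               ≡⟨ cong (restrict S) (trans (++-assoc (drop d Q′) [ x ] P₂) (sym drop-P′)) ⟩
        restrict S (drop d P′)                                ≡⟨ restrict-drop P′ n d k1 uP′ n∉P′ d≤k1 ⟩
        drop k1 P′                                            ∎
        where open ≡-Reasoning

      inner-run : Run n t I (n ∷ (a2 ∷ Q′) ++ x ∷ m ∷ P₂) (Wf n (suc (suc k1)) (suc d)) ((a2 ∷ Q′) ++ x ∷ m ∷ P₂ ++ [ n ])
      inner-run = subst₂ (λ w π → Run n t I (n ∷ a2 ∷ L′) w π)
                    (sym (Wf-fuel n (suc (suc k1)) (suc (suc d)) (suc d) (s≤s (s≤s d≤k1)) ≤-refl))
                    (cong (a2 ∷_) (++-assoc Q′ (x ∷ m ∷ P₂) [ n ]))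
                    (subst₂ (λ π π′ → Run n t I π (W n (suc d)) π′) (cong (λ c → n ∷ c ∷ L′) mis-ψ′) (cong (λ c → c ∷ L′ ++ [ n ]) mis-ψ′)
                      (Run-map (λ {ρ} ρ-ok → InCyclicOrder′⇒≢t ρ-ok , InCyclicOrder-⊆ {ρ = ρ} (n∉L′ ∘ ∈-drop⁻ d L′) S⊆S′ restrict-drop-L′ ρ-ok)
                        (IH (suc d) ψ′ (s≤s z≤n) (s≤s d≤k1) seed′ height′)))

    inner-runs : InnerRuns
    inner-runs []       x P₂ P≡ = inner-run-first x P₂ P≡
    inner-runs (q ∷ Q′) x P₂ P≡ with ∷-injective P≡
    ... | refl , P′≡ = Inner.inner-run Q′ x P₂ P′≡

  seed-shape : ∀ {ψ} → IsSeed n ψ → Σ ℕ λ a2 → Σ (List ℕ) λ P′ → ψ ≡ n ∷ a2 ∷ P′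
  seed-shape (_ , _ , _ , ((a2 ∷ P′) , refl) , _) = a2 , P′ , refl
  seed-shape (() , _ , _ , ([] , refl) , _)

  SegmentClaim : ℕ → Set
  SegmentClaim k = ∀ ψ → 1 ≤ k → k + 3 < n → IsSeed n ψ → Height n ψ k → SegmentRun k ψ

  segment-run : ∀ k → SegmentClaim k
  segment-run = <-rec SegmentClaim claim
    where
    claim : ∀ k → (∀ {j} → j < k → SegmentClaim j) → SegmentClaim k
    claim (suc k0) rec ψ _ k+3<n seed height with seed-shape seed
    claim (suc zero) rec .(n ∷ a2 ∷ P′) _ k+3<n seed height | a2 , P′ , refl =
      Walk.run-segment 0 a2 P′ seed height k+3<n (Walk.inner-runs-height1 0 a2 P′ seed height k+3<n refl)
    claim (suc (suc k1)) rec .(n ∷ a2 ∷ P′) _ k+3<n seed height | a2 , P′ , refl =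
      Walk.run-segment (suc k1) a2 P′ seed height k+3<n (Recursive.inner-runs k1 a2 P′ seed height k+3<n IH)
      where
      IH : ∀ k′ ψ′ → 1 ≤ k′ → k′ ≤ suc k1 → IsSeed n ψ′ → Height n ψ′ k′ → SegmentRun k′ ψ′
      IH k′ ψ′ 1≤k′ k′≤ = rec (s≤s k′≤) ψ′ 1≤k′ (≤-<-trans (+-monoˡ-≤ 3 (≤-trans k′≤ (n≤1+n (suc k1)))) k+3<n)

-- Hub seeds have height n − 2.
theorem1 : ∀ (n k : ℕ) → 4 ≤ n → 1 ≤ k → k + 3 < n →
    ∀ (ψ : Perm) → IsSeed n ψ → ¬ InHub n ψ → Height n ψ k →
    Seg n (shiftLast n ψ) (tilde n ψ) (W n k)
theorem1 (suc (suc (suc n3))) k (s≤s (s≤s (s≤s _))) 1≤k k+3<n ψ seed _ height =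
  Run⇒Seg (Segment.segment-run n3 k ψ 1≤k k+3<n seed height)
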